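{- Let $\Gamma$ be a finite simple unweighted digraph of order $n$, where $n$ is square-free or $n=2m$ with $m$ square-free. If $\Gamma$ is a restricted-normal digraph, then $\Gamma$ is a directed join of two normal digraphs.
   Context: The Laplacian is $L=D-A$ with $A$ the adjacency matrix (no loops) and $D$ the diagonal matrix of out-degrees. $\mathbf{e}$ is the all-ones vector; a restrictor matrix of order $n$ is an $n\times(n-1)$ matrix $Q$ with orthonormal columns orthogonal to $\mathbf{e}$. A digraph is normal if $L$ is normal, and restricted-normal if $L$ is not normal but $Q^*LQ$ is normal (independent of the choice of $Q$). For $\Gamma_1=(V_1,E_1)$, $\Gamma_2=(V_2,E_2)$ with $V_1\cap V_2=\emptyset$, the directed join is $\Gamma_1\overset{\rightarrow}{\vee}\Gamma_2=(V_1\sqcup V_2,E_1\sqcup E_2\sqcup\{(i,j):i\in V_1,j\in V_2\})$. -}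

module Defs where

open import Level using (Level; _⊔_)
open import Data.Bool using (Bool; true; false; if_then_else_)
open import Data.Nat as ℕ using (ℕ; zero; suc; _∸_)
open import Data.Nat.Divisibility using (_∣_)
open import Data.Fin using (Fin; zero; suc; _≟_; splitAt)
open import Data.Sum using (inj₁; inj₂)
open import Data.Product using (Σ; ∃; _×_; _,_)
open import Relation.Nullary using (¬_; does)
open import Relation.Binary.PropositionalEquality using (_≡_)
open import Function.Bundles using (_↔_; Inverse)
open import Algebra.Bundles using (CommutativeRing)
import Data.Integer.Properties as ℤP

record Digraph (n : ℕ) : Set where
  field
    adj      : Fin n → Fin n → Bool
    loopless : ∀ i → adj i i ≡ false
open Digraph public

module MatrixOps {c ℓ} (R : CommutativeRing c ℓ) where
  open CommutativeRing R hiding (zero)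

  Matrix : ℕ → ℕ → Set c
  Matrix m k = Fin m → Fin k → Carrier

  ∑ : ∀ {m} → (Fin m → Carrier) → Carrier
  ∑ {zero}  f = 0#
  ∑ {suc m} f = f zero + ∑ (λ i → f (suc i))

  _⊗_ : ∀ {m k p} → Matrix m k → Matrix k p → Matrix m p
  (M ⊗ N) i j = ∑ (λ t → M i t * N t j)

  transpose : ∀ {m k} → Matrix m k → Matrix k m
  transpose M i j = M j i

  _≋_ : ∀ {m k} → Matrix m k → Matrix m k → Set ℓ
  M ≋ N = ∀ i j → M i j ≈ N i j

  fromℕ : ℕ → Carrier
  fromℕ zero    = 0#
  fromℕ (suc k) = 1# + fromℕ k

  -- For a real matrix, M* = Mᵀ, so normality is M Mᵀ = Mᵀ M.
  IsNormal : ∀ {m} → Matrix m m → Set ℓ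
  IsNormal M = (M ⊗ transpose M) ≋ (transpose M ⊗ M)

  outdeg : ∀ {n} → Digraph n → Fin n → Carrier
  outdeg Γ i = ∑ (λ j → if adj Γ i j then 1# else 0#)

  laplacian : ∀ {n} → Digraph n → Matrix n n
  laplacian Γ i j =
    (if does (i ≟ j) then outdeg Γ i else 0#)
      - (if adj Γ i j then 1# else 0#)

  ones : ∀ {n} → Matrix n 1
  ones _ _ = 1#

  identity : ∀ {m} → Matrix m m
  identity i j = if does (i ≟ j) then 1# else 0#

  zeroM : ∀ {m k} → Matrix m k
  zeroM _ _ = 0#

  IsRestrictor : ∀ {n} → Matrix n (n ∸ 1) → Set ℓ
  IsRestrictor Q =
    ((transpose Q ⊗ Q) ≋ identity) × ((transpose Q ⊗ ones) ≋ zeroM)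

record IsChar0Field {c ℓ} (K : CommutativeRing c ℓ) : Set (c ⊔ ℓ) where
  open CommutativeRing K hiding (zero)
  open MatrixOps K using (fromℕ)
  field
    inverse : ∀ x → ¬ (x ≈ 0#) → ∃ λ y → x * y ≈ 1#
    char0   : ∀ k → ¬ (fromℕ (suc k) ≈ 0#)

open MatrixOps ℤP.+-*-commutativeRing public
  using () renaming (laplacian to laplacianℤ; IsNormal to IsNormalℤ)

NormalDigraph : ∀ {n} → Digraph n → Set
NormalDigraph Γ = IsNormalℤ (laplacianℤ Γ)

RestrictedNormalVia : ∀ {c ℓ} (K : CommutativeRing c ℓ) {n} →
  Digraph n → MatrixOps.Matrix K n (n ∸ 1) → Set ℓ
RestrictedNormalVia K Γ Q =
  ¬ NormalDigraph Γ ×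
  IsNormal ((transpose Q ⊗ laplacian Γ) ⊗ Q)
  where open MatrixOps K

directedJoin : ∀ {k m} → Digraph k → Digraph m → Fin (k ℕ.+ m) → Fin (k ℕ.+ m) → Bool
directedJoin {k} Γ₁ Γ₂ i j with splitAt k i | splitAt k j
... | inj₁ a | inj₁ b = adj Γ₁ a b
... | inj₁ a | inj₂ b = true
... | inj₂ a | inj₁ b = false
... | inj₂ a | inj₂ b = adj Γ₂ a b

IsJoinOfNormals : ∀ {n} → Digraph n → Set
IsJoinOfNormals {n} Γ =
  Σ ℕ λ k → Σ ℕ λ m → Σ (Digraph (suc k)) λ Γ₁ → Σ (Digraph (suc m)) λ Γ₂ →
    NormalDigraph Γ₁ × NormalDigraph Γ₂ ×
    Σ (Fin n ↔ Fin (suc k ℕ.+ suc m)) λ σ →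
      ∀ i j → adj Γ i j ≡ directedJoin Γ₁ Γ₂ (Inverse.to σ i) (Inverse.to σ j)

SquareFree : ℕ → Set
SquareFree n = ∀ d → d ℕ.* d ∣ n → d ≡ 1

{-# OPTIONS --safe #-}

-- Over a field of characteristic 0, orthonormality of the columns of Q and Qᵀ e = 0 make
-- [e | Q] invertible, whence Q Qᵀ = I - J/n.  For u = eᵢ - eⱼ the vector y = Qᵀ u satisfies
-- Q y = u, so normality of M = Qᵀ L Q, i.e. ‖Mᵀ y‖ = ‖M y‖, becomes
--   n (‖L u‖² - ‖Lᵀ u‖²) = (wᵢ - wⱼ)²,
-- where wⱼ = (eᵀ L)ⱼ is the out-degree minus the in-degree of j.  All entries are integers, so
-- the identity holds over ℤ.  As ‖L u‖² - ‖Lᵀ u‖² ≡ wᵢ - wⱼ modulo 2 and n is square-free or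
-- twice a square-free number, n divides wᵢ - wⱼ.  Since |wᵢ| < n, w equals some c on the set V₁
-- of vertices with w > 0 and c - n on the rest V₂; both are nonempty, for otherwise w = 0 and
-- the identity makes L normal.  Then ∑ w = 0 gives c = |V₂|, so ∑_{V₁} w = |V₁| |V₂| forces
-- every pair V₁ × V₂ to carry exactly the arc from V₁ to V₂.  The digraphs induced on V₁ and V₂
-- are then balanced and inherit the identity with wᵢ = wⱼ, which makes them normal.

module Submission where

open import Algebra.Bundles using (CommutativeRing)
open import Data.Nat using (ℕ; zero; suc)
open import Defs using (Digraph; IsChar0Field; module MatrixOps)

module DoubleNegation where

  import Level
  open import Data.Fin using (Fin; zero; suc)
  open import Data.Product using (∃; _,_)
  open import Relation.Nullary using (¬_)
  open import Relation.Nullary.Negation using (contradiction; negated-stable; ¬¬-map)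

  private
    variable
      a b : Level.Level
      A : Set a
      B : Set b

  return : A → ¬ ¬ A
  return x = contradiction x

  _>>=_ : ¬ ¬ A → (A → ¬ ¬ B) → ¬ ¬ B
  m >>= f = negated-stable (¬¬-map f m)

  ¬¬-∀-Fin : ∀ {p n} {P : Fin n → Set p} → (∀ i → ¬ ¬ P i) → ¬ ¬ (∀ i → P i)
  ¬¬-∀-Fin {n = zero}  _    = return (λ ())
  ¬¬-∀-Fin {n = suc n} ¬¬P = do
    p₀ ← ¬¬P zero
    ps ← ¬¬-∀-Fin (λ i → ¬¬P (suc i))
    return λ { zero → p₀ ; (suc i) → ps i }

  ¬∀⇒¬¬∃¬ : ∀ {p n} {P : Fin n → Set p} → ¬ (∀ i → P i) → ¬ ¬ (∃ λ i → ¬ P i)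
  ¬∀⇒¬¬∃¬ ¬∀P ¬∃¬P = ¬¬-∀-Fin (λ i ¬Pi → ¬∃¬P (i , ¬Pi)) ¬∀P

module MatrixAlgebra {c ℓ} (R : CommutativeRing c ℓ) where

  open import Data.Bool using (Bool; true; false; if_then_else_)
  open import Data.Fin using (Fin; zero; suc; _≟_)
  open import Data.Fin.Permutation using (Permutation′; _⟨$⟩ʳ_)
  open import Function using (_∘_)
  open import Relation.Nullary using (does)
  import Algebra.Properties.Semiring.Sum as SemiringSum
  import Algebra.Properties.Ring as RingProperties
  open import Defs

  open CommutativeRing R hiding (zero)
  open MatrixOps R public
  open import Relation.Binary.Reasoning.Setoid setoid

  private
    module Sum = SemiringSum semiring
    module RingP = RingProperties ring

  x-y≈x : ∀ {x y} → y ≈ 0# → x - y ≈ x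
  x-y≈x {x} y≈0 = trans (+-congˡ (trans (-‿cong y≈0) RingP.-0#≈0#)) (+-identityʳ x)

  ∑-cong : ∀ {m} {f g : Fin m → Carrier} → (∀ i → f i ≈ g i) → ∑ f ≈ ∑ g
  ∑-cong {zero}  f≈g = refl
  ∑-cong {suc m} f≈g = +-cong (f≈g zero) (∑-cong (f≈g ∘ suc))

  ∑≈sum : ∀ {m} (f : Fin m → Carrier) → ∑ f ≈ Sum.sum f
  ∑≈sum {zero}  f = refl
  ∑≈sum {suc m} f = +-congˡ (∑≈sum (f ∘ suc))

  ∑-distrib-+ : ∀ {m} (f g : Fin m → Carrier) → ∑ (λ i → f i + g i) ≈ ∑ f + ∑ g
  ∑-distrib-+ f g = begin
    ∑ (λ i → f i + g i)       ≈⟨ ∑≈sum (λ i → f i + g i) ⟩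
    Sum.sum (λ i → f i + g i) ≈⟨ Sum.∑-distrib-+ f g ⟩
    Sum.sum f + Sum.sum g     ≈⟨ +-cong (∑≈sum f) (∑≈sum g) ⟨
    ∑ f + ∑ g                 ∎

  ∑-permute : ∀ {m} (f : Fin m → Carrier) (π : Permutation′ m) → ∑ f ≈ ∑ (f ∘ (π ⟨$⟩ʳ_))
  ∑-permute f π = begin
    ∑ f                     ≈⟨ ∑≈sum f ⟩
    Sum.sum f               ≈⟨ Sum.sum-permute f π ⟩
    Sum.sum (f ∘ (π ⟨$⟩ʳ_)) ≈⟨ ∑≈sum (f ∘ (π ⟨$⟩ʳ_)) ⟨
    ∑ (f ∘ (π ⟨$⟩ʳ_))       ∎

  ∑-≈0 : ∀ {m} {f : Fin m → Carrier} → (∀ i → f i ≈ 0#) → ∑ f ≈ 0#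
  ∑-≈0 {zero}  f≈0 = refl
  ∑-≈0 {suc m} f≈0 = trans (+-cong (f≈0 zero) (∑-≈0 (f≈0 ∘ suc))) (+-identityˡ 0#)

  ∑-comm : ∀ {m k} (f : Fin m → Fin k → Carrier) →
           ∑ (λ i → ∑ (λ j → f i j)) ≈ ∑ (λ j → ∑ (λ i → f i j))
  ∑-comm {zero} {k} f = sym (∑-≈0 {k} (λ _ → refl))
  ∑-comm {suc m} f = trans (+-congˡ (∑-comm (f ∘ suc))) (sym (∑-distrib-+ (f zero) _))

  ∑-neg : ∀ {m} (f : Fin m → Carrier) → ∑ (λ i → - f i) ≈ - ∑ f
  ∑-neg {zero}  f = sym RingP.-0#≈0#
  ∑-neg {suc m} f = trans (+-congˡ (∑-neg (f ∘ suc))) (RingP.-‿+-comm (f zero) _)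

  ∑-distrib-- : ∀ {m} (f g : Fin m → Carrier) → ∑ (λ i → f i - g i) ≈ ∑ f - ∑ g
  ∑-distrib-- f g = trans (∑-distrib-+ f (λ i → - g i)) (+-congˡ (∑-neg g))

  *-distribˡ-∑ : ∀ {m} x (f : Fin m → Carrier) → x * ∑ f ≈ ∑ (λ i → x * f i)
  *-distribˡ-∑ {zero}  x f = zeroʳ x
  *-distribˡ-∑ {suc m} x f = trans (distribˡ x _ _) (+-congˡ (*-distribˡ-∑ x (f ∘ suc)))

  *-distribʳ-∑ : ∀ {m} x (f : Fin m → Carrier) → ∑ f * x ≈ ∑ (λ i → f i * x)
  *-distribʳ-∑ {zero}  x f = zeroˡ x
  *-distribʳ-∑ {suc m} x f = trans (distribʳ x _ _) (+-congˡ (*-distribʳ-∑ x (f ∘ suc)))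

  ∑-const : ∀ m x → ∑ {m} (λ _ → x) ≈ fromℕ m * x
  ∑-const zero    x = sym (zeroˡ x)
  ∑-const (suc m) x = begin
    x + ∑ {m} (λ _ → x)  ≈⟨ +-cong (sym (*-identityˡ x)) (∑-const m x) ⟩
    1# * x + fromℕ m * x ≈⟨ distribʳ x 1# (fromℕ m) ⟨
    fromℕ (suc m) * x    ∎

  ∑-δˡ : ∀ {m} (i : Fin m) (f : Fin m → Carrier) →
         ∑ (λ t → if does (i ≟ t) then f t else 0#) ≈ f i
  ∑-δˡ {suc m} zero f = trans (+-congˡ (∑-≈0 {m} (λ _ → refl))) (+-identityʳ (f zero))
  ∑-δˡ (suc i)      f = trans (+-identityˡ _) (∑-δˡ i (f ∘ suc))

  ∑-δʳ : ∀ {m} (i : Fin m) (f : Fin m → Carrier) →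
         ∑ (λ t → if does (t ≟ i) then f t else 0#) ≈ f i
  ∑-δʳ {suc m} zero f = trans (+-congˡ (∑-≈0 {m} (λ _ → refl))) (+-identityʳ (f zero))
  ∑-δʳ (suc i)      f = trans (+-identityˡ _) (∑-δʳ i (f ∘ suc))

  private
    δ-*ˡ : ∀ (b : Bool) x → (if b then 1# else 0#) * x ≈ (if b then x else 0#)
    δ-*ˡ true  x = *-identityˡ x
    δ-*ˡ false x = zeroˡ x

    δ-*ʳ : ∀ (b : Bool) x → x * (if b then 1# else 0#) ≈ (if b then x else 0#)
    δ-*ʳ true  x = *-identityʳ x
    δ-*ʳ false x = zeroʳ x

  ∑-identityˡ : ∀ {m} (i : Fin m) (f : Fin m → Carrier) → ∑ (λ t → identity i t * f t) ≈ f i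
  ∑-identityˡ i f = trans (∑-cong (λ t → δ-*ˡ (does (i ≟ t)) (f t))) (∑-δˡ i f)

  ∑-identityʳ : ∀ {m} (i : Fin m) (f : Fin m → Carrier) → ∑ (λ t → f t * identity t i) ≈ f i
  ∑-identityʳ i f = trans (∑-cong (λ t → δ-*ʳ (does (t ≟ i)) (f t))) (∑-δʳ i f)

  ≋-refl : ∀ {m k} {A : Matrix m k} → A ≋ A
  ≋-refl i j = refl

  ≋-sym : ∀ {m k} {A B : Matrix m k} → A ≋ B → B ≋ A
  ≋-sym A≋B i j = sym (A≋B i j)

  ≋-trans : ∀ {m k} {A B C : Matrix m k} → A ≋ B → B ≋ C → A ≋ C
  ≋-trans A≋B B≋C i j = trans (A≋B i j) (B≋C i j)

  ⊗-cong : ∀ {m k p} {A A′ : Matrix m k} {B B′ : Matrix k p} → A ≋ A′ → B ≋ B′ → (A ⊗ B) ≋ (A′ ⊗ B′)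
  ⊗-cong A≋A′ B≋B′ i j = ∑-cong (λ t → *-cong (A≋A′ i t) (B≋B′ t j))

  ⊗-congˡ : ∀ {m k p} {A : Matrix m k} {B B′ : Matrix k p} → B ≋ B′ → (A ⊗ B) ≋ (A ⊗ B′)
  ⊗-congˡ = ⊗-cong ≋-refl

  ⊗-congʳ : ∀ {m k p} {A A′ : Matrix m k} {B : Matrix k p} → A ≋ A′ → (A ⊗ B) ≋ (A′ ⊗ B)
  ⊗-congʳ A≋A′ = ⊗-cong A≋A′ ≋-refl

  ⊗-assoc : ∀ {m k p q} (A : Matrix m k) (B : Matrix k p) (C : Matrix p q) →
            ((A ⊗ B) ⊗ C) ≋ (A ⊗ (B ⊗ C))
  ⊗-assoc A B C i j = begin
    ∑ (λ t → ∑ (λ s → A i s * B s t) * C t j)   ≈⟨ ∑-cong (λ t → *-distribʳ-∑ (C t j) (λ s → A i s * B s t)) ⟩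
    ∑ (λ t → ∑ (λ s → A i s * B s t * C t j))   ≈⟨ ∑-comm (λ t s → A i s * B s t * C t j) ⟩
    ∑ (λ s → ∑ (λ t → A i s * B s t * C t j))   ≈⟨ ∑-cong (λ s → ∑-cong (λ t → *-assoc (A i s) (B s t) (C t j))) ⟩
    ∑ (λ s → ∑ (λ t → A i s * (B s t * C t j))) ≈⟨ ∑-cong (λ s → *-distribˡ-∑ (A i s) (λ t → B s t * C t j)) ⟨
    ∑ (λ s → A i s * ∑ (λ t → B s t * C t j))   ∎

  transpose-⊗ : ∀ {m k p} (A : Matrix m k) (B : Matrix k p) →
                transpose (A ⊗ B) ≋ (transpose B ⊗ transpose A)
  transpose-⊗ A B i j = ∑-cong (λ t → *-comm (A j t) (B t i))

  ⊗-identityˡ : ∀ {m k} (A : Matrix m k) → (identity ⊗ A) ≋ A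
  ⊗-identityˡ A i j = ∑-identityˡ i (λ t → A t j)

  ⊗-identityʳ : ∀ {m k} (A : Matrix m k) → (A ⊗ identity) ≋ A
  ⊗-identityʳ A i j = ∑-identityʳ j (A i)

  ‖_‖² : ∀ {m} → Matrix m 1 → Carrier
  ‖ z ‖² = (transpose z ⊗ z) zero zero

  sumEntries : ∀ {m} → Matrix m 1 → Carrier
  sumEntries z = ∑ (λ k → z k zero)

  ‖‖²-cong : ∀ {m} {z z′ : Matrix m 1} → z ≋ z′ → ‖ z ‖² ≈ ‖ z′ ‖²
  ‖‖²-cong z≋z′ = ∑-cong (λ k → *-cong (z≋z′ k zero) (z≋z′ k zero))

  ‖⊗‖² : ∀ {m k} (N : Matrix k m) (y : Matrix m 1) →
         ‖ N ⊗ y ‖² ≈ ((transpose y ⊗ (transpose N ⊗ N)) ⊗ y) zero zero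
  ‖⊗‖² N y = begin
    ((transpose (N ⊗ y)) ⊗ (N ⊗ y)) zero zero      ≈⟨ ⊗-congʳ {B = N ⊗ y} (transpose-⊗ N y) zero zero ⟩
    ((transpose y ⊗ transpose N) ⊗ (N ⊗ y)) zero zero ≈⟨ ⊗-assoc (transpose y) (transpose N) (N ⊗ y) zero zero ⟩
    (transpose y ⊗ (transpose N ⊗ (N ⊗ y))) zero zero ≈⟨ ⊗-congˡ {A = transpose y} (⊗-assoc (transpose N) N y) zero zero ⟨
    (transpose y ⊗ ((transpose N ⊗ N) ⊗ y)) zero zero ≈⟨ ⊗-assoc (transpose y) (transpose N ⊗ N) y zero zero ⟨
    ((transpose y ⊗ (transpose N ⊗ N)) ⊗ y) zero zero ∎

  IsNormal⇒‖ᵀ⊗‖²≈‖⊗‖² : ∀ {m} {M : Matrix m m} → IsNormal M → ∀ y → ‖ transpose M ⊗ y ‖² ≈ ‖ M ⊗ y ‖²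
  IsNormal⇒‖ᵀ⊗‖²≈‖⊗‖² {M = M} normal y = begin
    ‖ transpose M ⊗ y ‖²                          ≈⟨ ‖⊗‖² (transpose M) y ⟩
    ((transpose y ⊗ (M ⊗ transpose M)) ⊗ y) zero zero ≈⟨ ⊗-congʳ {B = y} (⊗-congˡ {A = transpose y} normal) zero zero ⟩
    ((transpose y ⊗ (transpose M ⊗ M)) ⊗ y) zero zero ≈⟨ ‖⊗‖² M y ⟨
    ‖ M ⊗ y ‖²                                    ∎

  column : ∀ {m k} → Matrix m k → Fin k → Matrix m 1
  column A j i _ = A i j

  basisDifference : ∀ {m} → Fin m → Fin m → Matrix m 1
  basisDifference i j t _ = identity t i - identity t j

  columnSum : ∀ {m k} → Matrix m k → Fin k → Carrier
  columnSum M j = ∑ (λ t → M t j)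

  columnDistance² : ∀ {m k} → Matrix m k → Fin k → Fin k → Carrier
  columnDistance² M i j = ∑ (λ t → (M t i - M t j) * (M t i - M t j))

  RestrictedNormalIdentity : ∀ {n} → Matrix n n → Fin n → Fin n → Set ℓ
  RestrictedNormalIdentity {n} M i j =
    fromℕ n * (columnDistance² M i j - columnDistance² (transpose M) i j) ≈
    (columnSum M i - columnSum M j) * (columnSum M i - columnSum M j)

  sumEntries-basisDifference : ∀ {m} (i j : Fin m) → sumEntries (basisDifference i j) ≈ 0#
  sumEntries-basisDifference i j = begin
    ∑ (λ t → identity t i - identity t j)  ≈⟨ ∑-distrib-- (λ t → identity t i) (λ t → identity t j) ⟩
    ∑ (λ t → identity t i) - ∑ (λ t → identity t j) ≈⟨ +-cong (∑-δʳ i (λ _ → 1#)) (-‿cong (∑-δʳ j (λ _ → 1#))) ⟩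
    1# - 1#                                ≈⟨ -‿inverseʳ 1# ⟩
    0#                                     ∎

  ⊗-basisDifference : ∀ {m k} (M : Matrix m k) i j t → (M ⊗ basisDifference i j) t zero ≈ M t i - M t j
  ⊗-basisDifference M i j t = begin
    ∑ (λ s → M t s * (identity s i - identity s j))         ≈⟨ ∑-cong (λ s → RingP.x[y-z]≈xy-xz (M t s) (identity s i) (identity s j)) ⟩
    ∑ (λ s → M t s * identity s i - M t s * identity s j)   ≈⟨ ∑-distrib-- (λ s → M t s * identity s i) (λ s → M t s * identity s j) ⟩
    ∑ (λ s → M t s * identity s i) - ∑ (λ s → M t s * identity s j) ≈⟨ +-cong (∑-identityʳ i (M t)) (-‿cong (∑-identityʳ j (M t))) ⟩
    M t i - M t j                                           ∎

  ‖⊗basisDifference‖² : ∀ {m k} (M : Matrix m k) i j → ‖ M ⊗ basisDifference i j ‖² ≈ columnDistance² M i j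
  ‖⊗basisDifference‖² M i j = ∑-cong (λ t → *-cong (⊗-basisDifference M i j t) (⊗-basisDifference M i j t))

  sumEntries-⊗basisDifference : ∀ {m k} (M : Matrix m k) i j →
                                sumEntries (M ⊗ basisDifference i j) ≈ columnSum M i - columnSum M j
  sumEntries-⊗basisDifference M i j =
    trans (∑-cong (⊗-basisDifference M i j)) (∑-distrib-- (λ t → M t i) (λ t → M t j))

  laplacian-rowSum : ∀ {n} (Γ : Digraph n) i → ∑ (laplacian Γ i) ≈ 0#
  laplacian-rowSum Γ i = begin
    ∑ (laplacian Γ i)                                          ≈⟨ ∑-distrib-- (λ t → if does (i ≟ t) then outdeg Γ i else 0#) (λ t → if adj Γ i t then 1# else 0#) ⟩
    ∑ (λ t → if does (i ≟ t) then outdeg Γ i else 0#) - outdeg Γ i ≈⟨ +-congʳ (∑-δˡ i (λ _ → outdeg Γ i)) ⟩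
    outdeg Γ i - outdeg Γ i                                    ≈⟨ -‿inverseʳ _ ⟩
    0#                                                         ∎

module IntegerImage {c ℓ} (K : CommutativeRing c ℓ) where

  open import Data.Nat as ℕ using (ℕ; zero; suc; _∸_)
  import Data.Nat.Properties as ℕP
  open import Data.Integer as ℤ using (ℤ; +_; -[1+_]; _⊖_)
  import Data.Integer.Properties as ℤP
  open import Data.Integer.Tactic.RingSolver using (solve-∀)
  import Data.Maybe
  open import Data.Sum using (inj₁; inj₂)
  open import Relation.Nullary.Negation using (contradiction)
  open import Relation.Nullary.Decidable using (dec⇒maybe)
  open import Relation.Binary.PropositionalEquality as ≡ using (_≡_)
  open import Algebra.Solver.Ring.AlmostCommutativeRing using (_-Raw-AlmostCommutative⟶_; fromCommutativeRing)
  import Algebra.Solver.Ring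
  import Algebra.Properties.Semiring.Mult as SemiringMult
  import Algebra.Properties.Ring as RingProperties
  import Algebra.Solver.CommutativeMonoid as CommutativeMonoidSolver
  open import Defs

  open CommutativeRing K hiding (zero)
  open MatrixOps K using (fromℕ)
  open import Relation.Binary.Reasoning.Setoid setoid

  private
    module Mult = SemiringMult semiring
    module RingP = RingProperties ring
    module +-Solver = CommutativeMonoidSolver +-commutativeMonoid

  fromℕ≈×1# : ∀ n → fromℕ n ≈ n Mult.× 1#
  fromℕ≈×1# zero    = refl
  fromℕ≈×1# (suc n) = +-congˡ (fromℕ≈×1# n)

  fromℕ-+ : ∀ m n → fromℕ (m ℕ.+ n) ≈ fromℕ m + fromℕ n
  fromℕ-+ m n = begin
    fromℕ (m ℕ.+ n)             ≈⟨ fromℕ≈×1# (m ℕ.+ n) ⟩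
    (m ℕ.+ n) Mult.× 1#         ≈⟨ Mult.×-homo-+ 1# m n ⟩
    m Mult.× 1# + n Mult.× 1#   ≈⟨ +-cong (fromℕ≈×1# m) (fromℕ≈×1# n) ⟨
    fromℕ m + fromℕ n           ∎

  fromℕ-* : ∀ m n → fromℕ (m ℕ.* n) ≈ fromℕ m * fromℕ n
  fromℕ-* m n = begin
    fromℕ (m ℕ.* n)             ≈⟨ fromℕ≈×1# (m ℕ.* n) ⟩
    (m ℕ.* n) Mult.× 1#         ≈⟨ Mult.×1-homo-* m n ⟩
    m Mult.× 1# * n Mult.× 1#   ≈⟨ *-cong (fromℕ≈×1# m) (fromℕ≈×1# n) ⟨
    fromℕ m * fromℕ n           ∎

  fromℕ-∸ : ∀ m n → n ℕ.≤ m → fromℕ (m ∸ n) ≈ fromℕ m - fromℕ n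
  fromℕ-∸ m n n≤m = begin
    fromℕ (m ∸ n)                          ≈⟨ RingP.//-rightDividesʳ (fromℕ n) (fromℕ (m ∸ n)) ⟨
    (fromℕ (m ∸ n) + fromℕ n) - fromℕ n    ≈⟨ +-congʳ (fromℕ-+ (m ∸ n) n) ⟨
    fromℕ (m ∸ n ℕ.+ n) - fromℕ n          ≡⟨ ≡.cong (λ k → fromℕ k - fromℕ n) (ℕP.m∸n+n≡m n≤m) ⟩
    fromℕ m - fromℕ n                      ∎

  fromℤ : ℤ → Carrier
  fromℤ (+ n)    = fromℕ n
  fromℤ -[1+ n ] = - fromℕ (suc n)

  fromℤ-cong : ∀ {x y} → x ≡ y → fromℤ x ≈ fromℤ y
  fromℤ-cong ≡.refl = refl

  fromℤ-neg : ∀ x → fromℤ (ℤ.- x) ≈ - fromℤ x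
  fromℤ-neg (+ zero)  = sym RingP.-0#≈0#
  fromℤ-neg (+ suc n) = refl
  fromℤ-neg -[1+ n ]  = sym (RingP.-‿involutive _)

  fromℤ-⊖ : ∀ m n → fromℤ (m ⊖ n) ≈ fromℕ m - fromℕ n
  fromℤ-⊖ m n with ℕP.≤-<-connex n m
  ... | inj₁ n≤m = trans (fromℤ-cong (ℤP.⊖-≥ n≤m)) (fromℕ-∸ m n n≤m)
  ... | inj₂ m<n = begin
    fromℤ (m ⊖ n)               ≡⟨ ≡.cong fromℤ (ℤP.⊖-< m<n) ⟩
    fromℤ (ℤ.- (+ (n ∸ m)))     ≈⟨ fromℤ-neg (+ (n ∸ m)) ⟩
    - fromℕ (n ∸ m)             ≈⟨ -‿cong (fromℕ-∸ n m (ℕP.<⇒≤ m<n)) ⟩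
    - (fromℕ n - fromℕ m)       ≈⟨ RingP.⁻¹-anti-homo‿- (fromℕ n) (fromℕ m) ⟩
    fromℕ m - fromℕ n           ∎

  private
    _+ₘ_ : ∀ {k} → +-Solver.Expr k → +-Solver.Expr k → +-Solver.Expr k
    _+ₘ_ = +-Solver._⊕_

    positivePart negativePart : ℤ → ℕ
    positivePart (+ n)    = n
    positivePart -[1+ n ] = 0
    negativePart (+ n)    = 0
    negativePart -[1+ n ] = suc n

    ⊖-parts : ∀ x → x ≡ + positivePart x ℤ.- + negativePart x
    ⊖-parts (+ n)    = ≡.cong +_ (≡.sym (ℕP.+-identityʳ n))
    ⊖-parts -[1+ n ] = ≡.sym (ℤP.+-identityˡ -[1+ n ])

    fromℤ-parts : ∀ x → fromℤ x ≈ fromℕ (positivePart x) - fromℕ (negativePart x)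
    fromℤ-parts (+ n)    = fromℤ-⊖ n 0
    fromℤ-parts -[1+ n ] = fromℤ-⊖ 0 (suc n)

    fromℤ-pos-neg : ∀ p q → fromℤ (+ p ℤ.- + q) ≈ fromℕ p - fromℕ q
    fromℤ-pos-neg p q = trans (fromℤ-cong (ℤP.m-n≡m⊖n p q)) (fromℤ-⊖ p q)

  fromℤ-+ : ∀ x y → fromℤ (x ℤ.+ y) ≈ fromℤ x + fromℤ y
  fromℤ-+ x y = begin
    fromℤ (x ℤ.+ y)                             ≡⟨ ≡.cong₂ (λ u v → fromℤ (u ℤ.+ v)) (⊖-parts x) (⊖-parts y) ⟩
    fromℤ ((+ p ℤ.- + q) ℤ.+ (+ r ℤ.- + s))     ≡⟨ ≡.cong fromℤ (regroup (+ p) (+ q) (+ r) (+ s)) ⟩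
    fromℤ (+ (p ℕ.+ r) ℤ.- + (q ℕ.+ s))         ≈⟨ fromℤ-pos-neg (p ℕ.+ r) (q ℕ.+ s) ⟩
    fromℕ (p ℕ.+ r) - fromℕ (q ℕ.+ s)           ≈⟨ +-cong (fromℕ-+ p r) (-‿cong (fromℕ-+ q s)) ⟩
    (P + R) - (Q + S)                           ≈⟨ +-congˡ (RingP.-‿+-comm Q S) ⟨
    (P + R) + (- Q + - S)                       ≈⟨ +-Solver.solve 4 (λ a b c d → (a +ₘ b) +ₘ (c +ₘ d) +-Solver.⊜ (a +ₘ c) +ₘ (b +ₘ d)) refl P R (- Q) (- S) ⟩
    (P - Q) + (R - S)                           ≈⟨ +-cong (fromℤ-parts x) (fromℤ-parts y) ⟨
    fromℤ x + fromℤ y                           ∎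
    where
    p = positivePart x ; q = negativePart x ; r = positivePart y ; s = negativePart y
    P = fromℕ p ; Q = fromℕ q ; R = fromℕ r ; S = fromℕ s
    regroup : ∀ (a b c d : ℤ) → (a ℤ.- b) ℤ.+ (c ℤ.- d) ≡ (a ℤ.+ c) ℤ.- (b ℤ.+ d)
    regroup = solve-∀

  private
    [a-b][c-d]≈ : ∀ a b c d → (a - b) * (c - d) ≈ (a * c + b * d) - (a * d + b * c)
    [a-b][c-d]≈ a b c d = begin
      (a - b) * (c - d)                      ≈⟨ RingP.[y-z]x≈yx-zx (c - d) a b ⟩
      a * (c - d) - b * (c - d)              ≈⟨ +-cong (RingP.x[y-z]≈xy-xz a c d) (-‿cong (RingP.x[y-z]≈xy-xz b c d)) ⟩
      (a * c - a * d) - (b * c - b * d)      ≈⟨ +-congˡ (RingP.⁻¹-anti-homo‿- (b * c) (b * d)) ⟩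
      (a * c - a * d) + (b * d - b * c)      ≈⟨ +-Solver.solve 4 (λ w x y z → (w +ₘ x) +ₘ (y +ₘ z) +-Solver.⊜ (w +ₘ y) +ₘ (x +ₘ z)) refl (a * c) (- (a * d)) (b * d) (- (b * c)) ⟩
      (a * c + b * d) + (- (a * d) - b * c)  ≈⟨ +-congˡ (RingP.-‿+-comm (a * d) (b * c)) ⟩
      (a * c + b * d) - (a * d + b * c)      ∎

  fromℤ-* : ∀ x y → fromℤ (x ℤ.* y) ≈ fromℤ x * fromℤ y
  fromℤ-* x y = begin
    fromℤ (x ℤ.* y)                                       ≡⟨ ≡.cong₂ (λ u v → fromℤ (u ℤ.* v)) (⊖-parts x) (⊖-parts y) ⟩
    fromℤ ((+ p ℤ.- + q) ℤ.* (+ r ℤ.- + s))               ≡⟨ ≡.cong fromℤ (expand p q r s) ⟩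
    fromℤ (+ (p ℕ.* r ℕ.+ q ℕ.* s) ℤ.- + (p ℕ.* s ℕ.+ q ℕ.* r))
      ≈⟨ fromℤ-pos-neg (p ℕ.* r ℕ.+ q ℕ.* s) (p ℕ.* s ℕ.+ q ℕ.* r) ⟩
    fromℕ (p ℕ.* r ℕ.+ q ℕ.* s) - fromℕ (p ℕ.* s ℕ.+ q ℕ.* r)
      ≈⟨ +-cong (fromℕ-+* p r q s) (-‿cong (fromℕ-+* p s q r)) ⟩
    (P * R + Q * S) - (P * S + Q * R)                     ≈⟨ [a-b][c-d]≈ P Q R S ⟨
    (P - Q) * (R - S)                                     ≈⟨ *-cong (fromℤ-parts x) (fromℤ-parts y) ⟨
    fromℤ x * fromℤ y                                     ∎
    where
    p = positivePart x ; q = negativePart x ; r = positivePart y ; s = negativePart y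
    P = fromℕ p ; Q = fromℕ q ; R = fromℕ r ; S = fromℕ s
    fromℕ-+* : ∀ a b c d → fromℕ (a ℕ.* b ℕ.+ c ℕ.* d) ≈ fromℕ a * fromℕ b + fromℕ c * fromℕ d
    fromℕ-+* a b c d = trans (fromℕ-+ (a ℕ.* b) (c ℕ.* d)) (+-cong (fromℕ-* a b) (fromℕ-* c d))
    ring-expand : ∀ (a b c d : ℤ) → (a ℤ.- b) ℤ.* (c ℤ.- d) ≡ (a ℤ.* c ℤ.+ b ℤ.* d) ℤ.- (a ℤ.* d ℤ.+ b ℤ.* c)
    ring-expand = solve-∀
    pos-+* : ∀ a b c d → + a ℤ.* + b ℤ.+ + c ℤ.* + d ≡ + (a ℕ.* b ℕ.+ c ℕ.* d)
    pos-+* a b c d = ≡.sym (≡.trans (ℤP.pos-+ (a ℕ.* b) (c ℕ.* d)) (≡.cong₂ ℤ._+_ (ℤP.pos-* a b) (ℤP.pos-* c d)))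
    expand : ∀ a b c d → (+ a ℤ.- + b) ℤ.* (+ c ℤ.- + d) ≡ + (a ℕ.* c ℕ.+ b ℕ.* d) ℤ.- + (a ℕ.* d ℕ.+ b ℕ.* c)
    expand a b c d = ≡.trans (ring-expand (+ a) (+ b) (+ c) (+ d))
      (≡.cong₂ ℤ._-_ (pos-+* a c b d) (pos-+* a d b c))

  fromℤ-1 : fromℤ (+ 1) ≈ 1#
  fromℤ-1 = +-identityʳ 1#

  fromℤ-- : ∀ x y → fromℤ (x ℤ.- y) ≈ fromℤ x - fromℤ y
  fromℤ-- x y = trans (fromℤ-+ x (ℤ.- y)) (+-congˡ (fromℤ-neg y))

  fromℤ-isMorphism : CommutativeRing.rawRing ℤP.+-*-commutativeRing -Raw-AlmostCommutative⟶ fromCommutativeRing K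
  fromℤ-isMorphism = record
    { ⟦_⟧ = fromℤ ; +-homo = fromℤ-+ ; *-homo = fromℤ-* ; -‿homo = fromℤ-neg ; 0-homo = refl ; 1-homo = fromℤ-1 }

  -- The ring solver needs decidable equality of coefficients, which K lacks; it works
  -- with integer coefficients transported along fromℤ.
  module Solver = Algebra.Solver.Ring (CommutativeRing.rawRing ℤP.+-*-commutativeRing)
    (fromCommutativeRing K) fromℤ-isMorphism
    (λ a b → Data.Maybe.map fromℤ-cong (dec⇒maybe (a ℤ.≟ b)))

  module _ (K-char0 : IsChar0Field K) where
    open IsChar0Field K-char0

    fromℤ≈0⇒≡0 : ∀ x → fromℤ x ≈ 0# → x ≡ + 0
    fromℤ≈0⇒≡0 (+ zero)  _   = ≡.refl
    fromℤ≈0⇒≡0 (+ suc k) x≈0 = contradiction x≈0 (char0 k)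
    fromℤ≈0⇒≡0 -[1+ k ]  x≈0 = contradiction (RingP.-‿injective (trans x≈0 (sym RingP.-0#≈0#))) (char0 k)

    fromℤ-injective : ∀ {x y} → fromℤ x ≈ fromℤ y → x ≡ y
    fromℤ-injective {x} {y} fx≈fy = ℤP.i-j≡0⇒i≡j x y (fromℤ≈0⇒≡0 (x ℤ.- y) (begin
      fromℤ (x ℤ.- y)     ≈⟨ fromℤ-- x y ⟩
      fromℤ x - fromℤ y   ≈⟨ +-congʳ fx≈fy ⟩
      fromℤ y - fromℤ y   ≈⟨ -‿inverseʳ (fromℤ y) ⟩
      0#                  ∎))

module LinearAlgebra {c ℓ} (K : CommutativeRing c ℓ) (K-char0 : IsChar0Field K) where

  open import Level using (_⊔_)
  open import Data.Fin using (Fin; zero; suc)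
  open import Data.Fin.Permutation as Perm using (Permutation′; _⟨$⟩ʳ_; _⟨$⟩ˡ_)
  open import Data.Product using (Σ; _×_; _,_)
  open import Function using (_∘_)
  open import Relation.Nullary using (¬_; yes; no)
  open import Relation.Nullary.Decidable using (¬¬-excluded-middle)
  open import Relation.Nullary.Negation using (¬¬-map)
  import Relation.Binary.PropositionalEquality as ≡
  open DoubleNegation

  open CommutativeRing K hiding (zero)
  open IsChar0Field K-char0
  open MatrixAlgebra K
  open IntegerImage K using (module Solver)
  open Solver using (solve; _:+_; _:-_; _:*_; :-_; _:=_)
  import Algebra.Properties.Ring as RingProperties
  private module RingP = RingProperties ring
  open import Relation.Binary.Reasoning.Setoid setoid

  1#≉0# : ¬ (1# ≈ 0#)
  1#≉0# 1≈0 = char0 0 (trans (+-identityʳ 1#) 1≈0)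

  LinearlyDependent : ∀ {k m} → (Fin k → Fin m → Carrier) → Set (c ⊔ ℓ)
  LinearlyDependent {k} {m} v =
    Σ (Fin k → Carrier) λ a → ¬ (∀ i → a i ≈ 0#) × (∀ r → ∑ (λ i → a i * v i r) ≈ 0#)

  dependent-permute : ∀ {k m} {v : Fin k → Fin m → Carrier} (π : Permutation′ k) →
                      LinearlyDependent (v ∘ (π ⟨$⟩ʳ_)) → LinearlyDependent v
  dependent-permute {v = v} π (a , a≉0 , av≈0) = a ∘ (π ⟨$⟩ˡ_) , a∘π⁻¹≉0 , av∘π⁻¹≈0
    where
    cancel : ∀ i → a (π ⟨$⟩ˡ (π ⟨$⟩ʳ i)) ≈ a i
    cancel i = reflexive (≡.cong a (Perm.inverseˡ π))
    a∘π⁻¹≉0 : ¬ (∀ i → a (π ⟨$⟩ˡ i) ≈ 0#)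
    a∘π⁻¹≉0 all≈0 = a≉0 (λ i → trans (sym (cancel i)) (all≈0 (π ⟨$⟩ʳ i)))
    av∘π⁻¹≈0 : ∀ r → ∑ (λ i → a (π ⟨$⟩ˡ i) * v i r) ≈ 0#
    av∘π⁻¹≈0 r = begin
      ∑ (λ i → a (π ⟨$⟩ˡ i) * v i r)                        ≈⟨ ∑-permute (λ i → a (π ⟨$⟩ˡ i) * v i r) π ⟩
      ∑ (λ i → a (π ⟨$⟩ˡ (π ⟨$⟩ʳ i)) * v (π ⟨$⟩ʳ i) r)      ≈⟨ ∑-cong (λ i → *-congʳ (cancel i)) ⟩
      ∑ (λ i → a i * v (π ⟨$⟩ʳ i) r)                        ≈⟨ av≈0 r ⟩
      0#                                                    ∎

  dependent-dropZeroColumn : ∀ {k m} {v : Fin (suc k) → Fin (suc m) → Carrier} → (∀ i → v i zero ≈ 0#) →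
                             LinearlyDependent (λ i r → v (suc i) (suc r)) → LinearlyDependent v
  dependent-dropZeroColumn {v = v} column≈0 (a , a≉0 , av≈0) = a′ , a′≉0 , a′v≈0
    where
    a′ : Fin _ → Carrier
    a′ zero    = 0#
    a′ (suc i) = a i
    a′≉0 : ¬ (∀ i → a′ i ≈ 0#)
    a′≉0 all≈0 = a≉0 (all≈0 ∘ suc)
    a′v≈0 : ∀ r → ∑ (λ i → a′ i * v i r) ≈ 0#
    a′v≈0 zero    = trans (+-cong (zeroˡ _) (∑-≈0 (λ i → trans (*-congˡ (column≈0 (suc i))) (zeroʳ (a i))))) (+-identityʳ 0#)
    a′v≈0 (suc r) = trans (+-cong (zeroˡ _) (av≈0 r)) (+-identityʳ 0#)

  -- One step of Gaussian elimination: subtracting multiples of the pivot vector v zero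
  -- (with v zero zero * β ≈ 1#) clears the first coordinate of the other vectors.
  dependent-eliminate : ∀ {k m} {v : Fin (suc k) → Fin (suc m) → Carrier} {β} → v zero zero * β ≈ 1# →
                        let w = λ i → v (suc i) zero * β in
                        LinearlyDependent (λ i r → v (suc i) (suc r) - w i * v zero (suc r)) →
                        LinearlyDependent v
  dependent-eliminate {k} {m} {v} {β} pivotβ≈1 (d , d≉0 , du≈0) = a , a≉0 , av≈0
    where
    w : Fin k → Carrier
    w i = v (suc i) zero * β
    a : Fin (suc k) → Carrier
    a zero    = - ∑ (λ i → d i * w i)
    a (suc i) = d i
    a≉0 : ¬ (∀ i → a i ≈ 0#)
    a≉0 all≈0 = d≉0 (all≈0 ∘ suc)
    reduced : ∀ r → ∑ (λ i → a i * v i r) ≈ ∑ (λ i → d i * (v (suc i) r - w i * v zero r))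
    reduced r = begin
      - D * x + S                                      ≈⟨ solve 3 (λ D x S → :- D :* x :+ S := S :- D :* x) refl D x S ⟩
      S - D * x                                        ≈⟨ +-congˡ (-‿cong (*-distribʳ-∑ x (λ i → d i * w i))) ⟩
      S - ∑ (λ i → d i * w i * x)                      ≈⟨ ∑-distrib-- (λ i → d i * v (suc i) r) (λ i → d i * w i * x) ⟨
      ∑ (λ i → d i * v (suc i) r - d i * w i * x)      ≈⟨ ∑-cong (λ i → solve 4 (λ d y w x → d :* y :- d :* w :* x := d :* (y :- w :* x)) refl (d i) (v (suc i) r) (w i) x) ⟩
      ∑ (λ i → d i * (v (suc i) r - w i * x))          ∎
      where
      D = ∑ (λ i → d i * w i)
      x = v zero r
      S = ∑ (λ i → d i * v (suc i) r)
    firstEntry≈0 : ∀ i → v (suc i) zero - w i * v zero zero ≈ 0#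
    firstEntry≈0 i = begin
      y - y * β * v zero zero   ≈⟨ +-congˡ (-‿cong (trans (*-assoc y β _) (*-congˡ (trans (*-comm β _) pivotβ≈1)))) ⟩
      y - y * 1#                ≈⟨ +-congˡ (-‿cong (*-identityʳ y)) ⟩
      y - y                     ≈⟨ -‿inverseʳ y ⟩
      0#                        ∎
      where y = v (suc i) zero
    av≈0 : ∀ r → ∑ (λ i → a i * v i r) ≈ 0#
    av≈0 zero    = trans (reduced zero) (∑-≈0 (λ i → trans (*-congˡ (firstEntry≈0 i)) (zeroʳ (d i))))
    av≈0 (suc r) = trans (reduced (suc r)) (du≈0 r)

  -- Equality in K is not decidable, so the case split on the first coordinates is only
  -- available under double negation.
  ¬¬-dependent : ∀ m (v : Fin (suc m) → Fin m → Carrier) → ¬ ¬ LinearlyDependent v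
  ¬¬-dependent zero    v = return ((λ _ → 1#) , (λ all≈0 → 1#≉0# (all≈0 zero)) , (λ ()))
  ¬¬-dependent (suc m) v = do
    no column≉0 ← ¬¬-excluded-middle
      where yes column≈0 → ¬¬-map (dependent-dropZeroColumn {v = v} column≈0) (¬¬-dependent m (λ i r → v (suc i) (suc r)))
    (p , vp≉0) ← ¬∀⇒¬¬∃¬ column≉0
    let π = Perm.transpose zero p
        (β , vpβ≈1) = inverse (v p zero) vp≉0
        v′ = v ∘ (π ⟨$⟩ʳ_)
    ¬¬-map (dependent-permute {v = v} π ∘ dependent-eliminate {v = v′} vpβ≈1)
           (¬¬-dependent m (λ i r → v′ (suc i) (suc r) - v′ (suc i) zero * β * v′ zero (suc r)))

  module _ {m} {A B : Matrix m m} (AB≋I : (A ⊗ B) ≋ identity) where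

    ⊗≋identity⇒cancelˡ : ∀ {p} (x : Matrix m p) → (A ⊗ (B ⊗ x)) ≋ x
    ⊗≋identity⇒cancelˡ x = ≋-trans (≋-sym (⊗-assoc A B x)) (≋-trans (⊗-congʳ AB≋I) (⊗-identityˡ x))

    ⊗≋identity⇒injective : (x : Matrix m 1) → (B ⊗ x) ≋ zeroM → x ≋ zeroM
    ⊗≋identity⇒injective x Bx≋0 i zero = begin
      x i zero              ≈⟨ ⊗≋identity⇒cancelˡ x i zero ⟨
      (A ⊗ (B ⊗ x)) i zero  ≈⟨ ∑-≈0 (λ r → trans (*-congˡ (Bx≋0 r zero)) (zeroʳ (A i r))) ⟩
      0#                    ∎

    -- The m + 1 vectors y, B e₀, …, B e_{m-1} are dependent, and the coefficient of y
    -- cannot vanish because B is injective.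
    ⊗≋identity⇒¬¬-solvable : (y : Matrix m 1) → ¬ ¬ (Σ (Matrix m 1) λ x → (B ⊗ x) ≋ y)
    ⊗≋identity⇒¬¬-solvable y = do
      (a , a≉0 , av≈0) ← ¬¬-dependent m v
      let (γ , a₀γ≈1) = inverse (a zero) (a₀≉0 a a≉0 av≈0)
      return ((λ k _ → - (γ * a (suc k))) , λ { i zero → solution a γ (av≈0 i) a₀γ≈1 })
      where
      v : Fin (suc m) → Fin m → Carrier
      v zero    r = y r zero
      v (suc k) r = B r k

      rest≈ : ∀ {r} (a : Fin (suc m) → Carrier) → ∑ (λ i → a i * v i r) ≈ 0# →
              ∑ (λ k → a (suc k) * B r k) ≈ - (a zero * y r zero)
      rest≈ a av≈0 = RingP.+-inverseʳ-unique _ _ av≈0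

      a₀≉0 : ∀ a → ¬ (∀ i → a i ≈ 0#) → (∀ r → ∑ (λ i → a i * v i r) ≈ 0#) → ¬ (a zero ≈ 0#)
      a₀≉0 a a≉0 av≈0 a₀≈0 = a≉0 λ
        { zero    → a₀≈0
        ; (suc k) → ⊗≋identity⇒injective (λ k _ → a (suc k)) (λ r _ → begin
            ∑ (λ k → B r k * a (suc k))   ≈⟨ ∑-cong (λ k → *-comm (B r k) (a (suc k))) ⟩
            ∑ (λ k → a (suc k) * B r k)   ≈⟨ rest≈ a (av≈0 r) ⟩
            - (a zero * y r zero)         ≈⟨ -‿cong (trans (*-congʳ a₀≈0) (zeroˡ _)) ⟩
            - 0#                          ≈⟨ RingP.-0#≈0# ⟩
            0#                            ∎) k zero }

      solution : ∀ {i} (a : Fin (suc m) → Carrier) γ → ∑ (λ i′ → a i′ * v i′ i) ≈ 0# → a zero * γ ≈ 1# →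
                 ∑ (λ k → B i k * - (γ * a (suc k))) ≈ y i zero
      solution {i} a γ av≈0 a₀γ≈1 = begin
        ∑ (λ k → B i k * - (γ * a (suc k)))  ≈⟨ ∑-cong (λ k → solve 3 (λ b g a → b :* :- (g :* a) := :- g :* (a :* b)) refl (B i k) γ (a (suc k))) ⟩
        ∑ (λ k → - γ * (a (suc k) * B i k))  ≈⟨ *-distribˡ-∑ (- γ) (λ k → a (suc k) * B i k) ⟨
        - γ * ∑ (λ k → a (suc k) * B i k)    ≈⟨ *-congˡ (rest≈ a av≈0) ⟩
        - γ * - (a zero * y i zero)          ≈⟨ solve 3 (λ g a y → :- g :* :- (a :* y) := (a :* g) :* y) refl γ (a zero) (y i zero) ⟩
        (a zero * γ) * y i zero              ≈⟨ trans (*-congʳ a₀γ≈1) (*-identityˡ (y i zero)) ⟩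
        y i zero                             ∎

    ⊗≋identity⇒¬¬-⊗≋identity : ¬ ¬ ((B ⊗ A) ≋ identity)
    ⊗≋identity⇒¬¬-⊗≋identity = ¬¬-map (λ eqs i j → eqs j i) (¬¬-∀-Fin (λ j → ¬¬-∀-Fin (columnEquation j)))
      where
      columnEquation : ∀ j i → ¬ ¬ ((B ⊗ A) i j ≈ identity i j)
      columnEquation j i = do
        (x , Bx≋eⱼ) ← ⊗≋identity⇒¬¬-solvable (column identity j)
        let Aⱼ≈x : ∀ t → A t j ≈ x t zero
            Aⱼ≈x t = begin
              A t j                                  ≈⟨ ⊗-identityʳ A t j ⟨
              (A ⊗ column identity j) t zero         ≈⟨ ⊗-congˡ {A = A} (≋-sym Bx≋eⱼ) t zero ⟩
              (A ⊗ (B ⊗ x)) t zero                   ≈⟨ ⊗≋identity⇒cancelˡ x t zero ⟩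
              x t zero                               ∎
        return (trans (∑-cong (λ t → *-congˡ (Aⱼ≈x t))) (Bx≋eⱼ i zero))

module Restrictor {c ℓ} (K : CommutativeRing c ℓ) (K-char0 : IsChar0Field K)
  {n′ : ℕ} (Q : MatrixOps.Matrix K (suc n′) n′) (isRestrictor : MatrixOps.IsRestrictor K Q) where

  open import Data.Fin using (zero; suc)
  open import Data.Product using (_,_; proj₁; proj₂)
  open import Relation.Nullary using (¬_)
  open import Relation.Nullary.Negation using (¬¬-map)

  open CommutativeRing K hiding (zero)
  open IsChar0Field K-char0
  open MatrixAlgebra K
  open LinearAlgebra K K-char0
  open IntegerImage K using (module Solver)
  open Solver using (solve; _:+_; _:-_; _:*_; _:=_)
  import Algebra.Properties.Ring as RingProperties
  private module RingP = RingProperties ring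
  open import Relation.Binary.Reasoning.Setoid setoid

  private
    n : ℕ
    n = suc n′
    QᵀQ≋I : (transpose Q ⊗ Q) ≋ identity
    QᵀQ≋I = proj₁ isRestrictor
    Qᵀe≋0 : (transpose Q ⊗ ones) ≋ zeroM
    Qᵀe≋0 = proj₂ isRestrictor

  1/n : Carrier
  1/n = proj₁ (inverse (fromℕ n) (char0 n′))

  n*1/n≈1 : fromℕ n * 1/n ≈ 1#
  n*1/n≈1 = proj₂ (inverse (fromℕ n) (char0 n′))

  -- [e | Q] has the left inverse [e/n | Q]ᵀ; read as a right inverse it says Q Qᵀ = I - J/n.
  augmented : Matrix n n
  augmented k zero    = 1#
  augmented k (suc a) = Q k a

  augmentedLeftInverse : Matrix n n
  augmentedLeftInverse zero    k = 1/n
  augmentedLeftInverse (suc a) k = Q k a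

  augmentedLeftInverse-⊗ : (augmentedLeftInverse ⊗ augmented) ≋ identity
  augmentedLeftInverse-⊗ zero zero = begin
    ∑ {n} (λ _ → 1/n * 1#)  ≈⟨ ∑-const n (1/n * 1#) ⟩
    fromℕ n * (1/n * 1#)    ≈⟨ *-congˡ (*-identityʳ 1/n) ⟩
    fromℕ n * 1/n           ≈⟨ n*1/n≈1 ⟩
    1#                      ∎
  augmentedLeftInverse-⊗ zero (suc b) = begin
    ∑ (λ k → 1/n * Q k b)   ≈⟨ *-distribˡ-∑ 1/n (λ k → Q k b) ⟨
    1/n * ∑ (λ k → Q k b)   ≈⟨ *-congˡ (trans (∑-cong (λ k → sym (*-identityʳ (Q k b)))) (Qᵀe≋0 b zero)) ⟩
    1/n * 0#                ≈⟨ zeroʳ 1/n ⟩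
    0#                      ∎
  augmentedLeftInverse-⊗ (suc a) zero    = Qᵀe≋0 a zero
  augmentedLeftInverse-⊗ (suc a) (suc b) = QᵀQ≋I a b

  QQᵀ≈I-1/n : ¬ ¬ (∀ k l → (Q ⊗ transpose Q) k l ≈ identity k l - 1/n)
  QQᵀ≈I-1/n = ¬¬-map rearrange (⊗≋identity⇒¬¬-⊗≋identity {A = augmentedLeftInverse} {B = augmented} augmentedLeftInverse-⊗)
    where
    rearrange : (augmented ⊗ augmentedLeftInverse) ≋ identity → ∀ k l → (Q ⊗ transpose Q) k l ≈ identity k l - 1/n
    rearrange SP≋I k l = begin
      G                     ≈⟨ solve 2 (λ g i → g := (i :+ g) :- i) refl G 1/n ⟩
      (1/n + G) - 1/n       ≈⟨ +-congʳ (trans (+-congʳ (sym (*-identityˡ 1/n))) (SP≋I k l)) ⟩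
      identity k l - 1/n    ∎
      where G = (Q ⊗ transpose Q) k l

  module _ (QQᵀ≈ : ∀ k l → (Q ⊗ transpose Q) k l ≈ identity k l - 1/n) where

    QQᵀ-⊗ : ∀ (z : Matrix n 1) k → ((Q ⊗ transpose Q) ⊗ z) k zero ≈ z k zero - 1/n * sumEntries z
    QQᵀ-⊗ z k = begin
      ∑ (λ l → (Q ⊗ transpose Q) k l * z l zero)                      ≈⟨ ∑-cong (λ l → *-congʳ {z l zero} (QQᵀ≈ k l)) ⟩
      ∑ (λ l → (identity k l - 1/n) * z l zero)                        ≈⟨ ∑-cong (λ l → RingP.[y-z]x≈yx-zx (z l zero) (identity k l) 1/n) ⟩
      ∑ (λ l → identity k l * z l zero - 1/n * z l zero)               ≈⟨ ∑-distrib-- (λ l → identity k l * z l zero) (λ l → 1/n * z l zero) ⟩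
      ∑ (λ l → identity k l * z l zero) - ∑ (λ l → 1/n * z l zero)     ≈⟨ +-cong (∑-identityˡ k (λ l → z l zero)) (-‿cong (sym (*-distribˡ-∑ 1/n (λ l → z l zero)))) ⟩
      z k zero - 1/n * sumEntries z                                    ∎

    Q⊗Qᵀ⊗-section : ∀ (z : Matrix n 1) → sumEntries z ≈ 0# → (Q ⊗ (transpose Q ⊗ z)) ≋ z
    Q⊗Qᵀ⊗-section z Σz≈0 k zero = begin
      (Q ⊗ (transpose Q ⊗ z)) k zero       ≈⟨ ⊗-assoc Q (transpose Q) z k zero ⟨
      ((Q ⊗ transpose Q) ⊗ z) k zero       ≈⟨ QQᵀ-⊗ z k ⟩
      z k zero - 1/n * sumEntries z        ≈⟨ x-y≈x (trans (*-congˡ Σz≈0) (zeroʳ 1/n)) ⟩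
      z k zero                             ∎

    ‖Qᵀ⊗‖² : ∀ (z : Matrix n 1) → ‖ transpose Q ⊗ z ‖² ≈ ‖ z ‖² - 1/n * (sumEntries z * sumEntries z)
    ‖Qᵀ⊗‖² z = begin
      ‖ transpose Q ⊗ z ‖²                                             ≈⟨ ‖⊗‖² (transpose Q) z ⟩
      ((transpose z ⊗ (Q ⊗ transpose Q)) ⊗ z) zero zero               ≈⟨ ⊗-assoc (transpose z) (Q ⊗ transpose Q) z zero zero ⟩
      ∑ (λ k → z k zero * ((Q ⊗ transpose Q) ⊗ z) k zero)             ≈⟨ ∑-cong (λ k → *-congˡ {z k zero} (QQᵀ-⊗ z k)) ⟩
      ∑ (λ k → z k zero * (z k zero - 1/n * Σz))                      ≈⟨ ∑-cong (λ k → RingP.x[y-z]≈xy-xz (z k zero) (z k zero) (1/n * Σz)) ⟩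
      ∑ (λ k → z k zero * z k zero - z k zero * (1/n * Σz))           ≈⟨ ∑-distrib-- (λ k → z k zero * z k zero) (λ k → z k zero * (1/n * Σz)) ⟩
      ‖ z ‖² - ∑ (λ k → z k zero * (1/n * Σz))                        ≈⟨ +-congˡ (-‿cong (*-distribʳ-∑ (1/n * Σz) (λ k → z k zero))) ⟨
      ‖ z ‖² - Σz * (1/n * Σz)                                         ≈⟨ +-congˡ (-‿cong (solve 2 (λ s i → s :* (i :* s) := i :* (s :* s)) refl Σz 1/n)) ⟩
      ‖ z ‖² - 1/n * (Σz * Σz)                                         ∎
      where Σz = sumEntries z

    -- For u ⊥ e we have Q (Qᵀ u) = u, so y = Qᵀ u satisfies M y = Qᵀ N u and Mᵀ y = Qᵀ Nᵀ u
    -- for M = Qᵀ N Q; normality of M equates the two squared lengths.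
    restrictedNormal⇒‖ᵀ⊗‖²≈‖⊗‖² : ∀ (N : Matrix n n) → IsNormal ((transpose Q ⊗ N) ⊗ Q) →
      ∀ (u : Matrix n 1) → sumEntries u ≈ 0# →
      ‖ transpose N ⊗ u ‖² - 1/n * (sumEntries (transpose N ⊗ u) * sumEntries (transpose N ⊗ u)) ≈
      ‖ N ⊗ u ‖² - 1/n * (sumEntries (N ⊗ u) * sumEntries (N ⊗ u))
    restrictedNormal⇒‖ᵀ⊗‖²≈‖⊗‖² N normal u Σu≈0 = begin
      ‖ transpose N ⊗ u ‖² - 1/n * (Σ (transpose N ⊗ u) * Σ (transpose N ⊗ u)) ≈⟨ ‖Qᵀ⊗‖² (transpose N ⊗ u) ⟨
      ‖ transpose Q ⊗ (transpose N ⊗ u) ‖²   ≈⟨ ‖‖²-cong Mᵀy≋QᵀNᵀu ⟨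
      ‖ transpose M ⊗ y ‖²                   ≈⟨ IsNormal⇒‖ᵀ⊗‖²≈‖⊗‖² normal y ⟩
      ‖ M ⊗ y ‖²                             ≈⟨ ‖‖²-cong My≋QᵀNu ⟩
      ‖ transpose Q ⊗ (N ⊗ u) ‖²             ≈⟨ ‖Qᵀ⊗‖² (N ⊗ u) ⟩
      ‖ N ⊗ u ‖² - 1/n * (Σ (N ⊗ u) * Σ (N ⊗ u)) ∎
      where
      Σ = sumEntries
      M = (transpose Q ⊗ N) ⊗ Q
      y = transpose Q ⊗ u
      Qy≋u : (Q ⊗ y) ≋ u
      Qy≋u = Q⊗Qᵀ⊗-section u Σu≈0
      My≋QᵀNu : (M ⊗ y) ≋ (transpose Q ⊗ (N ⊗ u))
      My≋QᵀNu = ≋-trans (⊗-assoc (transpose Q ⊗ N) Q y)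
                (≋-trans (⊗-congˡ {A = transpose Q ⊗ N} Qy≋u) (⊗-assoc (transpose Q) N u))
      Mᵀ≋QᵀNᵀQ : transpose M ≋ (transpose Q ⊗ (transpose N ⊗ Q))
      Mᵀ≋QᵀNᵀQ = ≋-trans (transpose-⊗ (transpose Q ⊗ N) Q) (⊗-congˡ {A = transpose Q} (transpose-⊗ (transpose Q) N))
      Mᵀy≋QᵀNᵀu : (transpose M ⊗ y) ≋ (transpose Q ⊗ (transpose N ⊗ u))
      Mᵀy≋QᵀNᵀu = ≋-trans (⊗-congʳ {B = y} Mᵀ≋QᵀNᵀQ)
                  (≋-trans (⊗-assoc (transpose Q) (transpose N ⊗ Q) y)
                  (⊗-congˡ {A = transpose Q} (≋-trans (⊗-assoc (transpose N) Q y) (⊗-congˡ {A = transpose N} Qy≋u))))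

    restrictedNormal⇒identity : ∀ (Γ : Digraph n) → IsNormal ((transpose Q ⊗ laplacian Γ) ⊗ Q) →
                                ∀ i j → RestrictedNormalIdentity (laplacian Γ) i j
    restrictedNormal⇒identity Γ normal i j = begin
      fromℕ n * (colD - rowD)                     ≈⟨ *-congˡ (+-congˡ (-‿cong rowD≈)) ⟩
      fromℕ n * (colD - (colD - 1/n * (Δ * Δ)))   ≈⟨ solve 4 (λ n c i d → n :* (c :- (c :- i :* d)) := (n :* i) :* d) refl (fromℕ n) colD 1/n (Δ * Δ) ⟩
      (fromℕ n * 1/n) * (Δ * Δ)                   ≈⟨ trans (*-congʳ n*1/n≈1) (*-identityˡ (Δ * Δ)) ⟩
      Δ * Δ                                       ∎
      where
      L = laplacian Γ
      u = basisDifference i j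
      colD = columnDistance² L i j
      rowD = columnDistance² (transpose L) i j
      Δ = columnSum L i - columnSum L j
      Σ = sumEntries
      ΣLᵀu≈0 : Σ (transpose L ⊗ u) ≈ 0#
      ΣLᵀu≈0 = begin
        Σ (transpose L ⊗ u)                      ≈⟨ sumEntries-⊗basisDifference (transpose L) i j ⟩
        ∑ (L i) - ∑ (L j)                        ≈⟨ +-cong (laplacian-rowSum Γ i) (-‿cong (laplacian-rowSum Γ j)) ⟩
        0# - 0#                                  ≈⟨ -‿inverseʳ 0# ⟩
        0#                                       ∎
      rowD≈ : rowD ≈ colD - 1/n * (Δ * Δ)
      rowD≈ = begin
        rowD                                                          ≈⟨ ‖⊗basisDifference‖² (transpose L) i j ⟨
        ‖ transpose L ⊗ u ‖²                                          ≈⟨ x-y≈x (trans (*-congˡ (*-congʳ ΣLᵀu≈0)) (trans (*-congˡ (zeroˡ _)) (zeroʳ 1/n))) ⟨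
        ‖ transpose L ⊗ u ‖² - 1/n * (Σ (transpose L ⊗ u) * Σ (transpose L ⊗ u))
          ≈⟨ restrictedNormal⇒‖ᵀ⊗‖²≈‖⊗‖² L normal u (sumEntries-basisDifference i j) ⟩
        ‖ L ⊗ u ‖² - 1/n * (Σ (L ⊗ u) * Σ (L ⊗ u))
          ≈⟨ +-cong (‖⊗basisDifference‖² L i j) (-‿cong (*-congˡ (*-cong (sumEntries-⊗basisDifference L i j) (sumEntries-⊗basisDifference L i j)))) ⟩
        colD - 1/n * (Δ * Δ)                                          ∎

module IntegerMatrices where

  open import Data.Nat as ℕ using (zero; suc)
  open import Data.Fin using (Fin; zero; suc)
  open import Function using (_∘_)
  import Data.Nat.Properties as ℕP
  open import Data.Integer as ℤ using (ℤ; +_; -[1+_]; _≤_)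
  open import Data.Product using (∃; _,_; proj₁; proj₂)
  import Data.Integer.Properties as ℤP
  open import Relation.Binary.PropositionalEquality using (_≡_; refl; sym; cong; cong₂; trans; module ≡-Reasoning)
  open import Data.Integer.Tactic.RingSolver using (solve-∀)
  open MatrixAlgebra ℤP.+-*-commutativeRing public

  fromℕ≡+ : ∀ m → fromℕ m ≡ + m
  fromℕ≡+ zero    = refl
  fromℕ≡+ (suc m) = cong (ℤ._+_ (+ 1)) (fromℕ≡+ m)

  ∑-const-ℤ : ∀ m (x : ℤ) → ∑ {m} (λ _ → x) ≡ + m ℤ.* x
  ∑-const-ℤ m x = trans (∑-const m x) (cong (ℤ._* x) (fromℕ≡+ m))

  ∑-mono-≤ : ∀ {m} {f g : Fin m → ℤ} → (∀ i → f i ≤ g i) → ∑ f ≤ ∑ g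
  ∑-mono-≤ {zero}  f≤g = ℤP.≤-refl
  ∑-mono-≤ {suc m} f≤g = ℤP.+-mono-≤ (f≤g zero) (∑-mono-≤ (λ i → f≤g (suc i)))

  gram : ∀ {m k} → Matrix m k → Matrix k k
  gram M = transpose M ⊗ M

  columnDistance²-polarization : ∀ {m k} (M : Matrix m k) i j →
    columnDistance² M i j ≡ gram M i i ℤ.+ gram M j j ℤ.- + 2 ℤ.* gram M i j
  columnDistance²-polarization M i j = begin
    ∑ (λ t → (M t i ℤ.- M t j) ℤ.* (M t i ℤ.- M t j))
      ≡⟨ ∑-cong (λ t → expand (M t i) (M t j)) ⟩
    ∑ (λ t → (M t i ℤ.* M t i ℤ.+ M t j ℤ.* M t j) ℤ.- + 2 ℤ.* (M t i ℤ.* M t j))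
      ≡⟨ ∑-distrib-- (λ t → M t i ℤ.* M t i ℤ.+ M t j ℤ.* M t j) (λ t → + 2 ℤ.* (M t i ℤ.* M t j)) ⟩
    ∑ (λ t → M t i ℤ.* M t i ℤ.+ M t j ℤ.* M t j) ℤ.- ∑ (λ t → + 2 ℤ.* (M t i ℤ.* M t j))
      ≡⟨ cong₂ ℤ._-_ (∑-distrib-+ (λ t → M t i ℤ.* M t i) (λ t → M t j ℤ.* M t j))
                      (sym (*-distribˡ-∑ (+ 2) (λ t → M t i ℤ.* M t j))) ⟩
    gram M i i ℤ.+ gram M j j ℤ.- + 2 ℤ.* gram M i j ∎
    where
    open ≡-Reasoning
    expand : ∀ x y → (x ℤ.- y) ℤ.* (x ℤ.- y) ≡ (x ℤ.* x ℤ.+ y ℤ.* y) ℤ.- + 2 ℤ.* (x ℤ.* y)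
    expand = solve-∀

  private
    naturalSquare≡self+even : ∀ n → ∃ λ k → n ℕ.* n ≡ n ℕ.+ 2 ℕ.* k
    naturalSquare≡self+even zero    = 0 , refl
    naturalSquare≡self+even (suc n) with naturalSquare≡self+even n
    ... | k , n²≡n+2k = k ℕ.+ n , trans (expandˡ n) (trans (cong (λ x → suc n ℕ.+ n ℕ.+ x) n²≡n+2k) (expandʳ n k))
      where
      open import Data.Nat.Tactic.RingSolver renaming (solve-∀ to ℕ-solve-∀)
      expandˡ : ∀ n → suc n ℕ.* suc n ≡ suc n ℕ.+ n ℕ.+ n ℕ.* n
      expandˡ = ℕ-solve-∀
      expandʳ : ∀ n k → suc n ℕ.+ n ℕ.+ (n ℕ.+ 2 ℕ.* k) ≡ suc n ℕ.+ 2 ℕ.* (k ℕ.+ n)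
      expandʳ = ℕ-solve-∀

  square≡self+even : ∀ x → ∃ λ k → x ℤ.* x ≡ x ℤ.+ + 2 ℤ.* k
  square≡self+even (+ n) with naturalSquare≡self+even n
  ... | k , n²≡n+2k = + k , trans (sym (ℤP.pos-* n n))
                           (trans (cong +_ n²≡n+2k) (trans (ℤP.pos-+ n (2 ℕ.* k)) (cong (ℤ._+_ (+ n)) (ℤP.pos-* 2 k))))
  square≡self+even -[1+ n ] with naturalSquare≡self+even (suc n)
  ... | k , n²≡n+2k = + suc n ℤ.+ + k , trans (cong +_ n²≡n+2k)
                      (trans (ℤP.pos-+ (suc n) (2 ℕ.* k)) (trans (cong (ℤ._+_ (+ suc n)) (ℤP.pos-* 2 k)) (negate (+ suc n) (+ k))))
    where
    negate : ∀ x k → x ℤ.+ + 2 ℤ.* k ≡ ℤ.- x ℤ.+ + 2 ℤ.* (x ℤ.+ k)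
    negate = solve-∀

  columnDistance²-parity : ∀ {m k} (M : Matrix m k) i j →
    ∃ λ e → columnDistance² M i j ≡ (columnSum M i ℤ.- columnSum M j) ℤ.+ + 2 ℤ.* e
  columnDistance²-parity M i j = ∑ (λ t → proj₁ (square≡self+even (c t))) , (begin
    ∑ (λ t → c t ℤ.* c t)                                        ≡⟨ ∑-cong (λ t → proj₂ (square≡self+even (c t))) ⟩
    ∑ (λ t → c t ℤ.+ + 2 ℤ.* proj₁ (square≡self+even (c t)))     ≡⟨ ∑-distrib-+ c (λ t → + 2 ℤ.* proj₁ (square≡self+even (c t))) ⟩
    ∑ c ℤ.+ ∑ (λ t → + 2 ℤ.* proj₁ (square≡self+even (c t)))     ≡⟨ cong₂ ℤ._+_ (∑-distrib-- (λ t → M t i) (λ t → M t j))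
                                                                                 (sym (*-distribˡ-∑ (+ 2) (λ t → proj₁ (square≡self+even (c t))))) ⟩
    (columnSum M i ℤ.- columnSum M j) ℤ.+ + 2 ℤ.* ∑ (λ t → proj₁ (square≡self+even (c t))) ∎)
    where
    open ≡-Reasoning
    c : _ → ℤ
    c t = M t i ℤ.- M t j

  import Algebra.Properties.Ring as RingProperties
  module RingP = RingProperties ℤP.+-*-ring

  x-y≡-[y-x] : ∀ x y → x ℤ.- y ≡ ℤ.- (y ℤ.- x)
  x-y≡-[y-x] x y = sym (RingP.⁻¹-anti-homo‿- y x)

  distanceDefect : ∀ {m} → Matrix m m → Fin m → Fin m → ℤ
  distanceDefect M i j = columnDistance² M i j ℤ.- columnDistance² (transpose M) i j

  0≤∑ : ∀ {m} {f : Fin m → ℤ} → (∀ i → + 0 ≤ f i) → + 0 ≤ ∑ f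
  0≤∑ {m} 0≤f = ℤP.≤-trans (ℤP.≤-reflexive (sym (∑-≈0 {m} (λ _ → refl)))) (∑-mono-≤ 0≤f)

  ∑≡0⇒≡0 : ∀ {m} {f : Fin m → ℤ} → (∀ i → + 0 ≤ f i) → ∑ f ≡ + 0 → ∀ i → f i ≡ + 0
  ∑≡0⇒≡0 {f = f} 0≤f ∑f≡0 zero    = head≡0 (0≤f zero) (0≤∑ (0≤f ∘ suc)) ∑f≡0
    where
    head≡0 : ∀ {x y} → + 0 ≤ x → + 0 ≤ y → x ℤ.+ y ≡ + 0 → x ≡ + 0
    head≡0 {+ p} {+ q} _ _ p+q≡0 = cong +_ (ℕP.m+n≡0⇒m≡0 p (ℤP.+-injective p+q≡0))
  ∑≡0⇒≡0 {f = f} 0≤f ∑f≡0 (suc i) = ∑≡0⇒≡0 (0≤f ∘ suc) tail≡0 i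
    where
    tail≡0 : ∑ (f ∘ suc) ≡ + 0
    tail≡0 = trans (sym (ℤP.+-identityˡ _)) (trans (cong (ℤ._+ ∑ (f ∘ suc)) (sym (∑≡0⇒≡0 0≤f ∑f≡0 zero))) ∑f≡0)

  ∑∑-antisymmetric : ∀ {m} (H : Fin m → Fin m → ℤ) → (∀ x y → H x y ≡ ℤ.- H y x) →
                     ∑ (λ x → ∑ (λ y → H x y)) ≡ + 0
  ∑∑-antisymmetric H antisym = ℤP.*-cancelˡ-≡ (+ 2) S (+ 0) (begin
    + 2 ℤ.* S          ≡⟨ double S ⟩
    S ℤ.+ S            ≡⟨ cong (ℤ._+_ S) S≡-S ⟩
    S ℤ.- S            ≡⟨ ℤP.+-inverseʳ S ⟩
    + 0                ∎)
    where
    open ≡-Reasoning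
    S = ∑ (λ x → ∑ (λ y → H x y))
    double : ∀ x → + 2 ℤ.* x ≡ x ℤ.+ x
    double = solve-∀
    S≡-S : S ≡ ℤ.- S
    S≡-S = trans (∑-comm H) (trans (∑-cong (λ y → trans (∑-cong (λ x → antisym x y)) (∑-neg (H y)))) (∑-neg (λ y → ∑ (H y))))

module LaplacianTransfer {c ℓ} (K : CommutativeRing c ℓ) (K-char0 : IsChar0Field K) where

  open import Data.Bool using (true; false; if_then_else_)
  open import Data.Fin using (Fin; zero; suc; _≟_)
  open import Data.Integer as ℤ using (ℤ; +_)
  open import Relation.Nullary using (does)
  open import Relation.Nullary.Decidable using (decidable-stable)
  open import Relation.Nullary.Negation using (¬¬-map)
  open import Defs using (Digraph; adj)
  module ℤM = IntegerMatrices

  open CommutativeRing K hiding (zero)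
  open MatrixAlgebra K
  open IntegerImage K
  open import Relation.Binary.Reasoning.Setoid setoid

  fromℤ-∑ : ∀ {m} (f : Fin m → ℤ) → fromℤ (ℤM.∑ f) ≈ ∑ (λ i → fromℤ (f i))
  fromℤ-∑ {zero}  f = refl
  fromℤ-∑ {suc m} f = trans (fromℤ-+ (f zero) (ℤM.∑ (λ i → f (suc i)))) (+-congˡ (fromℤ-∑ (λ i → f (suc i))))

  fromℤ-laplacian : ∀ {n} (Γ : Digraph n) i j → fromℤ (ℤM.laplacian Γ i j) ≈ laplacian Γ i j
  fromℤ-laplacian Γ i j = begin
    fromℤ (diagonalℤ ℤ.- arcℤ i j)      ≈⟨ fromℤ-- diagonalℤ (arcℤ i j) ⟩
    fromℤ diagonalℤ - fromℤ (arcℤ i j)  ≈⟨ +-cong (fromℤ-if (does (i ≟ j)) fromℤ-outdeg) (-‿cong (fromℤ-arc i j)) ⟩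
    laplacian Γ i j                    ∎
    where
    arcℤ : ∀ i j → ℤ
    arcℤ i j = if adj Γ i j then + 1 else + 0
    diagonalℤ = if does (i ≟ j) then ℤM.outdeg Γ i else + 0
    fromℤ-arc : ∀ i j → fromℤ (arcℤ i j) ≈ (if adj Γ i j then 1# else 0#)
    fromℤ-arc i j with adj Γ i j
    ... | true  = fromℤ-1
    ... | false = refl
    fromℤ-outdeg : fromℤ (ℤM.outdeg Γ i) ≈ outdeg Γ i
    fromℤ-outdeg = trans (fromℤ-∑ (arcℤ i)) (∑-cong (fromℤ-arc i))
    fromℤ-if : ∀ b → fromℤ (ℤM.outdeg Γ i) ≈ outdeg Γ i →
               fromℤ (if b then ℤM.outdeg Γ i else + 0) ≈ (if b then outdeg Γ i else 0#)
    fromℤ-if true  eq = eq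
    fromℤ-if false _  = refl

  module _ {n} {M : ℤM.Matrix n n} {M′ : Matrix n n} (fromℤ-M : ∀ i j → fromℤ (M i j) ≈ M′ i j) where

    private
      fromℤ-square-difference : ∀ a b → fromℤ ((a ℤ.- b) ℤ.* (a ℤ.- b)) ≈ (fromℤ a - fromℤ b) * (fromℤ a - fromℤ b)
      fromℤ-square-difference a b = trans (fromℤ-* (a ℤ.- b) (a ℤ.- b)) (*-cong (fromℤ-- a b) (fromℤ-- a b))

    fromℤ-columnSum : ∀ j → fromℤ (ℤM.columnSum M j) ≈ columnSum M′ j
    fromℤ-columnSum j = trans (fromℤ-∑ (λ t → M t j)) (∑-cong (λ t → fromℤ-M t j))

    fromℤ-columnDistance² : ∀ i j → fromℤ (ℤM.columnDistance² M i j) ≈ columnDistance² M′ i j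
    fromℤ-columnDistance² i j = trans (fromℤ-∑ (λ t → (M t i ℤ.- M t j) ℤ.* (M t i ℤ.- M t j)))
      (∑-cong (λ t → trans (fromℤ-square-difference (M t i) (M t j))
                           (*-cong (+-cong (fromℤ-M t i) (-‿cong (fromℤ-M t j))) (+-cong (fromℤ-M t i) (-‿cong (fromℤ-M t j))))))

    fromℤ-rowDistance² : ∀ i j → fromℤ (ℤM.columnDistance² (ℤM.transpose M) i j) ≈ columnDistance² (transpose M′) i j
    fromℤ-rowDistance² i j = trans (fromℤ-∑ (λ t → (M i t ℤ.- M j t) ℤ.* (M i t ℤ.- M j t)))
      (∑-cong (λ t → trans (fromℤ-square-difference (M i t) (M j t))
                           (*-cong (+-cong (fromℤ-M i t) (-‿cong (fromℤ-M j t))) (+-cong (fromℤ-M i t) (-‿cong (fromℤ-M j t))))))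

    fromℤ-reflects-identity : ∀ i j → RestrictedNormalIdentity M′ i j → ℤM.RestrictedNormalIdentity M i j
    fromℤ-reflects-identity i j identity′ = fromℤ-injective K-char0 (begin
      fromℤ (ℤM.fromℕ n ℤ.* (ℤM.columnDistance² M i j ℤ.- ℤM.columnDistance² (ℤM.transpose M) i j))
        ≈⟨ fromℤ-* (ℤM.fromℕ n) (ℤM.columnDistance² M i j ℤ.- ℤM.columnDistance² (ℤM.transpose M) i j) ⟩
      fromℤ (ℤM.fromℕ n) * fromℤ (ℤM.columnDistance² M i j ℤ.- ℤM.columnDistance² (ℤM.transpose M) i j)
        ≈⟨ *-cong (fromℤ-cong (ℤM.fromℕ≡+ n))
                  (trans (fromℤ-- (ℤM.columnDistance² M i j) (ℤM.columnDistance² (ℤM.transpose M) i j))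
                         (+-cong (fromℤ-columnDistance² i j) (-‿cong (fromℤ-rowDistance² i j)))) ⟩
      fromℕ n * (columnDistance² M′ i j - columnDistance² (transpose M′) i j)
        ≈⟨ identity′ ⟩
      (columnSum M′ i - columnSum M′ j) * (columnSum M′ i - columnSum M′ j)
        ≈⟨ *-cong Δ≈ Δ≈ ⟨
      (fromℤ (ℤM.columnSum M i) - fromℤ (ℤM.columnSum M j)) * (fromℤ (ℤM.columnSum M i) - fromℤ (ℤM.columnSum M j))
        ≈⟨ fromℤ-square-difference (ℤM.columnSum M i) (ℤM.columnSum M j) ⟨
      fromℤ ((ℤM.columnSum M i ℤ.- ℤM.columnSum M j) ℤ.* (ℤM.columnSum M i ℤ.- ℤM.columnSum M j)) ∎)
      where
      Δ≈ : fromℤ (ℤM.columnSum M i) - fromℤ (ℤM.columnSum M j) ≈ columnSum M′ i - columnSum M′ j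
      Δ≈ = +-cong (fromℤ-columnSum i) (-‿cong (fromℤ-columnSum j))

  -- The identity over ℤ is decidable, so the double negation coming from the linear algebra
  -- over K can be discharged.
  restrictedNormal⇒ℤ-identity : ∀ {n′} (Γ : Digraph (suc n′)) (Q : Matrix (suc n′) n′) → IsRestrictor Q →
                                IsNormal ((transpose Q ⊗ laplacian Γ) ⊗ Q) →
                                ∀ i j → ℤM.RestrictedNormalIdentity (ℤM.laplacian Γ) i j
  restrictedNormal⇒ℤ-identity Γ Q isRestrictor normal i j = decidable-stable (_ ℤ.≟ _) (¬¬-map
    (λ QQᵀ≈ → fromℤ-reflects-identity {M = ℤM.laplacian Γ} (fromℤ-laplacian Γ) i j (restrictedNormal⇒identity QQᵀ≈ Γ normal i j))
    QQᵀ≈I-1/n)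
    where open Restrictor K K-char0 Q isRestrictor

module SquareFreeDivisibility where

  open import Data.Nat as ℕ using (ℕ; suc; NonZero; _*_; _+_)
  import Data.Nat.Properties as ℕP
  open import Data.Nat.Divisibility
  open import Data.Nat.GCD using (gcd; GCD; gcd-GCD; gcd[m,n]∣m; gcd[m,n]∣n; gcd[m,n]≢0; GCD-*)
  open import Data.Nat.Coprimality using (Coprime; GCD≡1⇒coprime; coprime-divisor)
  open import Data.Nat.Primality using (Prime; prime?; euclidsLemma)
  open import Data.Nat.Tactic.RingSolver using (solve-∀)
  open import Data.Integer as ℤ using (ℤ; +_; -[1+_])
  import Data.Integer.Properties as ℤP
  import Data.Integer.Tactic.RingSolver as ℤSolver
  open import Data.Product using (Σ; ∃; _×_; _,_)
  open import Data.Sum using (_⊎_; inj₁; inj₂; [_,_])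
  open import Function using (id)
  open import Relation.Nullary.Decidable using (from-yes)
  open import Relation.Binary.PropositionalEquality using (_≡_; refl; sym; trans; cong; cong₂; subst; subst₂)
  open import Defs using (SquareFree)

  SquareFreeOrTwiceSquareFree : ℕ → Set
  SquareFreeOrTwiceSquareFree n = SquareFree n ⊎ Σ ℕ (λ m → SquareFree m × n ≡ 2 * m)

  -- With g = gcd m D, m = m₁ g and D = D₁ g for coprime m₁, D₁; from m₁ g ∣ D₁ D₁ g g
  -- we get m₁ ∣ g, so m₁ * m₁ ∣ m and square-freeness forces m₁ = 1.
  squareFree∣square⇒∣ : ∀ {m} D .{{_ : NonZero m}} → SquareFree m → m ∣ D * D → m ∣ D
  squareFree∣square⇒∣ {m} D sf m∣D² with gcd[m,n]∣m m D | gcd[m,n]∣n m D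
  ... | divides m₁ m≡m₁g | divides D₁ D≡D₁g = subst (_∣ D) (sym m≡g) (gcd[m,n]∣n m D)
    where
    g = gcd m D
    instance
      g≢0 : NonZero g
      g≢0 = ℕ.≢-nonZero (gcd[m,n]≢0 m D (inj₁ (ℕ.≢-nonZero⁻¹ m)))
    m₁⊥D₁ : Coprime m₁ D₁
    m₁⊥D₁ = GCD≡1⇒coprime (GCD-* (subst (GCD (m₁ * g) (D₁ * g)) (sym (ℕP.*-identityˡ g))
                                    (subst₂ (λ a b → GCD a b g) m≡m₁g D≡D₁g (gcd-GCD m D))))
    regroup : ∀ a b → (a * b) * (a * b) ≡ (a * (a * b)) * b
    regroup = solve-∀
    m₁g∣D₁D₁gg : m₁ * g ∣ (D₁ * (D₁ * g)) * g
    m₁g∣D₁D₁gg = subst₂ _∣_ m≡m₁g (trans (cong₂ _*_ D≡D₁g D≡D₁g) (regroup D₁ g)) m∣D²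
    m₁∣g : m₁ ∣ g
    m₁∣g = coprime-divisor m₁⊥D₁ (coprime-divisor m₁⊥D₁ (*-cancelʳ-∣ g m₁g∣D₁D₁gg))
    m₁≡1 : m₁ ≡ 1
    m₁≡1 = sf m₁ (subst (m₁ * m₁ ∣_) (trans (ℕP.*-comm g m₁) (sym m≡m₁g)) (*-monoˡ-∣ m₁ m₁∣g))
    m≡g : m ≡ g
    m≡g = trans m≡m₁g (trans (cong (_* g) m₁≡1) (ℕP.*-identityˡ g))

  prime∣square⇒∣ : ∀ {p} k → Prime p → p ∣ k * k → p ∣ k
  prime∣square⇒∣ k p-prime p∣k² = [ id , id ] (euclidsLemma k k p-prime p∣k²)

  -- In the case n = 2m, 2 ∣ D² gives 2 ∣ D and, by parity, 2 ∣ S; halving both reduces to m ∣ D / 2.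
  ∣square⇒∣ : ∀ n .{{_ : NonZero n}} → SquareFreeOrTwiceSquareFree n →
              ∀ S D → n * S ≡ D * D → 2 ∣ S + D → n ∣ D
  ∣square⇒∣ n (inj₁ sf) S D nS≡D² _ = squareFree∣square⇒∣ D sf (divides S (trans (sym nS≡D²) (ℕP.*-comm n S)))
  ∣square⇒∣ _ (inj₂ (m , sf , refl)) S D 2mS≡D² 2∣S+D with 2∣D | 2∣S
    where
    2∣D : 2 ∣ D
    2∣D = prime∣square⇒∣ D (from-yes (prime? 2)) (divides (m * S) (trans (sym 2mS≡D²) (regroup m S)))
      where
      regroup : ∀ m S → 2 * m * S ≡ m * S * 2
      regroup = solve-∀
    2∣S : 2 ∣ S
    2∣S = ∣m+n∣m⇒∣n (subst (2 ∣_) (ℕP.+-comm S D) 2∣S+D) 2∣D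
  ... | divides D′ refl | divides S′ refl = subst (_∣ D′ * 2) (ℕP.*-comm m 2) (*-monoˡ-∣ 2 m∣D′)
    where
    instance
      m≢0 : NonZero m
      m≢0 = ℕ.≢-nonZero λ { refl → ℕ.≢-nonZero⁻¹ (2 * 0) refl }
    quarter : ∀ m S D → 2 * m * (S * 2) ≡ D * 2 * (D * 2) → m * S ≡ D * D
    quarter m S D eq = ℕP.*-cancelˡ-≡ (m * S) (D * D) 4 (trans (regroupˡ m S) (trans eq (regroupʳ D)))
      where
      regroupˡ : ∀ m S → 4 * (m * S) ≡ 2 * m * (S * 2)
      regroupˡ = solve-∀
      regroupʳ : ∀ D → D * 2 * (D * 2) ≡ 4 * (D * D)
      regroupʳ = solve-∀
    m∣D′ : m ∣ D′
    m∣D′ = squareFree∣square⇒∣ D′ sf (divides S′ (trans (sym (quarter m S′ D′ 2mS≡D²)) (ℕP.*-comm m S′)))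

  private
    square≡+∣∣² : ∀ d → d ℤ.* d ≡ + (ℤ.∣ d ∣ * ℤ.∣ d ∣)
    square≡+∣∣² (+ d)    = sym (ℤP.pos-* d d)
    square≡+∣∣² -[1+ d ] = refl

    2∣∣2*t∣ : ∀ t → 2 ∣ ℤ.∣ + 2 ℤ.* t ∣
    2∣∣2*t∣ t = divides ℤ.∣ t ∣ (trans (ℤP.abs-* (+ 2) t) (ℕP.*-comm 2 ℤ.∣ t ∣))

  ∣square⇒∣ℤ : ∀ n .{{_ : NonZero n}} → SquareFreeOrTwiceSquareFree n →
               ∀ s d t → + n ℤ.* s ≡ d ℤ.* d → s ≡ d ℤ.+ + 2 ℤ.* t → ∃ λ q → d ≡ + n ℤ.* q
  ∣square⇒∣ℤ (suc _) _ -[1+ _ ] d _ ns≡d² _ with trans ns≡d² (square≡+∣∣² d)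
  ... | ()
  ∣square⇒∣ℤ n hyp (+ S) (+ D) t nS≡D² S≡D+2t
    with ∣square⇒∣ n hyp S D (ℤP.+-injective (trans (ℤP.pos-* n S) (trans nS≡D² (square≡+∣∣² (+ D))))) 2∣S+D
    where
    regroup : ∀ D T → D ℤ.+ + 2 ℤ.* T ℤ.+ D ≡ + 2 ℤ.* (D ℤ.+ T)
    regroup = ℤSolver.solve-∀
    2∣S+D : 2 ∣ S + D
    2∣S+D = subst (2 ∣_) (cong ℤ.∣_∣ (sym (trans (ℤP.pos-+ S D) (trans (cong (ℤ._+ + D) S≡D+2t) (regroup (+ D) t)))))
                  (2∣∣2*t∣ (+ D ℤ.+ t))
  ... | divides q D≡qn = + q , trans (cong +_ D≡qn) (trans (ℤP.pos-* q n) (ℤP.*-comm (+ q) (+ n)))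
  ∣square⇒∣ℤ n hyp (+ S) -[1+ D ] t nS≡D² S≡D+2t
    with ∣square⇒∣ n hyp S (suc D) (ℤP.+-injective (trans (ℤP.pos-* n S) nS≡D²)) 2∣S+D
    where
    regroup : ∀ D T → ℤ.- D ℤ.+ + 2 ℤ.* T ℤ.+ D ≡ + 2 ℤ.* T
    regroup = ℤSolver.solve-∀
    2∣S+D : 2 ∣ S + suc D
    2∣S+D = subst (2 ∣_) (cong ℤ.∣_∣ (sym (trans (ℤP.pos-+ S (suc D)) (trans (cong (ℤ._+ + suc D) S≡D+2t) (regroup (+ suc D) t)))))
                  (2∣∣2*t∣ t)
  ... | divides q D≡qn = ℤ.- + q , trans (cong (λ x → ℤ.- + x) D≡qn)
                                        (trans (cong ℤ.-_ (trans (ℤP.pos-* q n) (ℤP.*-comm (+ q) (+ n)))) (ℤP.neg-distribʳ-* (+ n) (+ q)))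

module IntegerLaplacian where

  open import Data.Bool using (Bool; true; false; if_then_else_)
  open import Data.Nat as ℕ using (ℕ; zero; suc)
  open import Data.Fin using (Fin; zero; suc; _≟_)
  open import Data.Integer as ℤ using (ℤ; +_; _≤_; _<_)
  import Data.Integer.Properties as ℤP
  open import Data.Integer.Tactic.RingSolver using (solve-∀)
  open import Data.Product using (∃; _,_)
  open import Relation.Nullary using (Dec; yes; no; does)
  open import Function using (_∘_)
  open import Relation.Nullary.Decidable using (dec-false)
  open import Relation.Binary.PropositionalEquality using (_≡_; _≢_; refl; sym; trans; cong; cong₂; subst; module ≡-Reasoning)
  open import Defs using (Digraph; adj; NormalDigraph)
  open IntegerMatrices

  bit : Bool → ℤ
  bit b = if b then + 1 else + 0

  arc : ∀ {n} → Digraph n → Fin n → Fin n → ℤ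
  arc Γ i j = bit (adj Γ i j)

  bit*bit : ∀ b → bit b ℤ.* bit b ≡ bit b
  bit*bit true  = refl
  bit*bit false = refl

  module _ {n} (Γ : Digraph n) where

    private
      L : Matrix n n
      L = laplacian Γ

    indegree : Fin n → ℤ
    indegree i = ∑ (λ t → arc Γ t i)

    imbalance : Fin n → ℤ
    imbalance = columnSum L

    laplacian-offDiagonal : ∀ {i j} → i ≢ j → L i j ≡ ℤ.- arc Γ i j
    laplacian-offDiagonal {i} {j} i≢j =
      trans (cong (λ b → (if b then outdeg Γ i else + 0) ℤ.- arc Γ i j) (dec-false (i ≟ j) i≢j)) (ℤP.+-identityˡ _)

    imbalance≡out-in : ∀ i → imbalance i ≡ outdeg Γ i ℤ.- indegree i
    imbalance≡out-in i = trans (∑-distrib-- (λ t → if does (t ≟ i) then outdeg Γ t else + 0) (λ t → arc Γ t i))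
                               (cong (ℤ._- indegree i) (∑-δʳ i (outdeg Γ)))

    imbalance≡∑arcBalance : ∀ i → imbalance i ≡ ∑ (λ t → arc Γ i t ℤ.- arc Γ t i)
    imbalance≡∑arcBalance i = trans (imbalance≡out-in i) (sym (∑-distrib-- (arc Γ i) (λ t → arc Γ t i)))

    ∑-imbalance≡0 : ∑ imbalance ≡ + 0
    ∑-imbalance≡0 = trans (sym (∑-comm L)) (∑-≈0 (laplacian-rowSum Γ))

    gram-diagonal : ∀ i → gram L i i ℤ.- gram (transpose L) i i ≡ ℤ.- imbalance i
    gram-diagonal i = begin
      ∑ (λ t → L t i ℤ.* L t i) ℤ.- ∑ (λ t → L i t ℤ.* L i t)  ≡⟨ sym (∑-distrib-- (λ t → L t i ℤ.* L t i) (λ t → L i t ℤ.* L i t)) ⟩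
      ∑ (λ t → L t i ℤ.* L t i ℤ.- L i t ℤ.* L i t)            ≡⟨ ∑-cong (λ t → squares (t ≟ i)) ⟩
      ∑ (λ t → arc Γ t i ℤ.- arc Γ i t)                        ≡⟨ ∑-distrib-- (λ t → arc Γ t i) (arc Γ i) ⟩
      indegree i ℤ.- outdeg Γ i                                ≡⟨ x-y≡-[y-x] (indegree i) (outdeg Γ i) ⟩
      ℤ.- (outdeg Γ i ℤ.- indegree i)                          ≡⟨ cong ℤ.-_ (imbalance≡out-in i) ⟨
      ℤ.- imbalance i                                          ∎
      where
      open ≡-Reasoning
      negSquares : ∀ x y → ℤ.- x ℤ.* ℤ.- x ℤ.- ℤ.- y ℤ.* ℤ.- y ≡ x ℤ.* x ℤ.- y ℤ.* y
      negSquares = solve-∀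
      squares : ∀ {t} → Dec (t ≡ i) → L t i ℤ.* L t i ℤ.- L i t ℤ.* L i t ≡ arc Γ t i ℤ.- arc Γ i t
      squares {t} (yes refl) = trans (ℤP.+-inverseʳ (L t t ℤ.* L t t)) (sym (ℤP.+-inverseʳ (arc Γ t t)))
      squares {t} (no t≢i) = begin
        L t i ℤ.* L t i ℤ.- L i t ℤ.* L i t
          ≡⟨ cong₂ (λ u v → u ℤ.* u ℤ.- v ℤ.* v) (laplacian-offDiagonal t≢i) (laplacian-offDiagonal (t≢i ∘ sym)) ⟩
        ℤ.- arc Γ t i ℤ.* ℤ.- arc Γ t i ℤ.- ℤ.- arc Γ i t ℤ.* ℤ.- arc Γ i t
          ≡⟨ negSquares (arc Γ t i) (arc Γ i t) ⟩
        arc Γ t i ℤ.* arc Γ t i ℤ.- arc Γ i t ℤ.* arc Γ i t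
          ≡⟨ cong₂ ℤ._-_ (bit*bit (adj Γ t i)) (bit*bit (adj Γ i t)) ⟩
        arc Γ t i ℤ.- arc Γ i t ∎

    -- Polarisation recovers the Gram matrices of L and Lᵀ from the column and row distances,
    -- and their diagonals agree once the imbalance vanishes.
    balanced⇒normal : (∀ i → imbalance i ≡ + 0) →
                      (∀ i j → columnDistance² L i j ≡ columnDistance² (transpose L) i j) → NormalDigraph Γ
    balanced⇒normal w≡0 colD≡rowD i j = ℤP.*-cancelˡ-≡ (+ 2) (gram (transpose L) i j) (gram L i j) (begin
      + 2 ℤ.* Rᵢⱼ                                      ≡⟨ isolate Rᵢᵢ Rⱼⱼ Rᵢⱼ ⟩
      Rᵢᵢ ℤ.+ Rⱼⱼ ℤ.- (Rᵢᵢ ℤ.+ Rⱼⱼ ℤ.- + 2 ℤ.* Rᵢⱼ)    ≡⟨ cong₂ (λ x y → x ℤ.- y) (cong₂ ℤ._+_ (diagonal i) (diagonal j))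
                                                          (sym (columnDistance²-polarization (transpose L) i j)) ⟩
      Cᵢᵢ ℤ.+ Cⱼⱼ ℤ.- columnDistance² (transpose L) i j ≡⟨ cong (λ x → Cᵢᵢ ℤ.+ Cⱼⱼ ℤ.- x) (sym (colD≡rowD i j)) ⟩
      Cᵢᵢ ℤ.+ Cⱼⱼ ℤ.- columnDistance² L i j           ≡⟨ cong (λ x → Cᵢᵢ ℤ.+ Cⱼⱼ ℤ.- x) (columnDistance²-polarization L i j) ⟩
      Cᵢᵢ ℤ.+ Cⱼⱼ ℤ.- (Cᵢᵢ ℤ.+ Cⱼⱼ ℤ.- + 2 ℤ.* Cᵢⱼ)    ≡⟨ isolate Cᵢᵢ Cⱼⱼ Cᵢⱼ ⟨
      + 2 ℤ.* Cᵢⱼ                                      ∎)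
      where
      open ≡-Reasoning
      C = gram L ; R = gram (transpose L)
      Cᵢᵢ = C i i ; Cⱼⱼ = C j j ; Cᵢⱼ = C i j ; Rᵢᵢ = R i i ; Rⱼⱼ = R j j ; Rᵢⱼ = R i j
      isolate : ∀ a b c → + 2 ℤ.* c ≡ a ℤ.+ b ℤ.- (a ℤ.+ b ℤ.- + 2 ℤ.* c)
      isolate = solve-∀
      diagonal : ∀ k → R k k ≡ C k k
      diagonal k = sym (ℤP.i-j≡0⇒i≡j (C k k) (R k k) (trans (gram-diagonal k) (cong ℤ.-_ (w≡0 k))))

    identity-parity : ∀ i j → ∃ λ e →
      columnDistance² L i j ℤ.- columnDistance² (transpose L) i j ≡ (imbalance i ℤ.- imbalance j) ℤ.+ + 2 ℤ.* e
    identity-parity i j with columnDistance²-parity L i j | columnDistance²-parity (transpose L) i j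
    ... | e , colD≡ | e′ , rowD≡ = e ℤ.- e′ , (begin
      columnDistance² L i j ℤ.- columnDistance² (transpose L) i j
        ≡⟨ cong₂ ℤ._-_ colD≡ rowD≡ ⟩
      (Δ ℤ.+ + 2 ℤ.* e) ℤ.- ((∑ (L i) ℤ.- ∑ (L j)) ℤ.+ + 2 ℤ.* e′)
        ≡⟨ cong (λ x → (Δ ℤ.+ + 2 ℤ.* e) ℤ.- (x ℤ.+ + 2 ℤ.* e′)) (cong₂ ℤ._-_ (laplacian-rowSum Γ i) (laplacian-rowSum Γ j)) ⟩
      (Δ ℤ.+ + 2 ℤ.* e) ℤ.- (+ 0 ℤ.- + 0 ℤ.+ + 2 ℤ.* e′)
        ≡⟨ regroup Δ e e′ ⟩
      Δ ℤ.+ + 2 ℤ.* (e ℤ.- e′) ∎)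
      where
      open ≡-Reasoning
      Δ = imbalance i ℤ.- imbalance j
      regroup : ∀ d e e′ → (d ℤ.+ + 2 ℤ.* e) ℤ.- (+ 0 ℤ.- + 0 ℤ.+ + 2 ℤ.* e′) ≡ d ℤ.+ + 2 ℤ.* (e ℤ.- e′)
      regroup = solve-∀

    private
      δ : Fin n → Fin n → ℤ
      δ i t = if does (i ≟ t) then + 1 else + 0

      bit-bit≤1 : ∀ a b → bit a ℤ.- bit b ≤ + 1
      bit-bit≤1 true  true  = ℤ.+≤+ ℕ.z≤n
      bit-bit≤1 true  false = ℤP.≤-refl
      bit-bit≤1 false true  = ℤ.-≤+
      bit-bit≤1 false false = ℤ.+≤+ ℕ.z≤n

      ∑-offDiagonal≤ : ∀ i (f : Fin n → ℤ) → f i ≡ + 0 → (∀ t → f t ≤ + 1) → ∑ f < + n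
      ∑-offDiagonal≤ i f fi≡0 f≤1 = ℤP.i≤pred[j]⇒i<j (ℤP.≤-trans (∑-mono-≤ f≤1-δ) (ℤP.≤-reflexive ∑1-δ≡pred-n))
        where
        f≤1-δ : ∀ t → f t ≤ + 1 ℤ.- δ i t
        f≤1-δ t with i ≟ t
        ... | yes refl = ℤP.≤-reflexive fi≡0
        ... | no _     = f≤1 t
        ∑1-δ≡pred-n : ∑ (λ t → + 1 ℤ.- δ i t) ≡ ℤ.pred (+ n)
        ∑1-δ≡pred-n = trans (∑-distrib-- (λ _ → + 1) (δ i))
          (trans (cong₂ ℤ._-_ (trans (∑-const-ℤ n (+ 1)) (ℤP.*-identityʳ (+ n))) (∑-δˡ i (λ _ → + 1))) (ℤP.+-comm (+ n) ℤ.-1ℤ))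

      arcBalance≡0 : ∀ i → arc Γ i i ℤ.- arc Γ i i ≡ + 0
      arcBalance≡0 i = ℤP.+-inverseʳ (arc Γ i i)

    imbalance<n : ∀ i → imbalance i < + n
    imbalance<n i = subst (_< + n) (sym (imbalance≡∑arcBalance i))
      (∑-offDiagonal≤ i (λ t → arc Γ i t ℤ.- arc Γ t i) (arcBalance≡0 i) (λ t → bit-bit≤1 (adj Γ i t) (adj Γ t i)))

    -n<imbalance : ∀ i → ℤ.- + n < imbalance i
    -n<imbalance i = subst (ℤ.- + n <_) (ℤP.neg-involutive (imbalance i)) (ℤP.neg-mono-< (subst (_< + n) -w≡
      (∑-offDiagonal≤ i (λ t → arc Γ t i ℤ.- arc Γ i t) (arcBalance≡0 i) (λ t → bit-bit≤1 (adj Γ t i) (adj Γ i t)))))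
      where
      -w≡ : ∑ (λ t → arc Γ t i ℤ.- arc Γ i t) ≡ ℤ.- imbalance i
      -w≡ = trans (∑-cong (λ t → x-y≡-[y-x] (arc Γ t i) (arc Γ i t)))
           (trans (∑-neg (λ t → arc Γ i t ℤ.- arc Γ t i)) (cong ℤ.-_ (sym (imbalance≡∑arcBalance i))))

module FinPartition where

  open import Data.Nat as ℕ using (ℕ; zero; suc)
  import Data.Nat.Properties as ℕP
  open import Data.Fin using (Fin; zero; suc)
  open import Data.Sum using (_⊎_; inj₁; inj₂)
  open import Data.Product using (Σ; _,_)
  open import Data.Integer as ℤ using (ℤ)
  import Data.Integer.Properties as ℤP
  open import Relation.Nullary using (¬_; yes; no)
  open import Level using (0ℓ)
  open import Relation.Unary using (Pred; Decidable)
  open import Relation.Binary.PropositionalEquality using (_≡_; refl; sym; trans; cong)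
  open IntegerMatrices using (∑)

  record Partition {n} (P : Pred (Fin n) 0ℓ) (a b : ℕ) : Set where
    field
      embed          : Fin a ⊎ Fin b → Fin n
      classify       : Fin n → Fin a ⊎ Fin b
      embed∘classify : ∀ i → embed (classify i) ≡ i
      classify∘embed : ∀ x → classify (embed x) ≡ x
      inside         : ∀ x → P (embed (inj₁ x))
      outside        : ∀ y → ¬ P (embed (inj₂ y))
      size           : a ℕ.+ b ≡ n
      ∑-split        : ∀ (h : Fin n → ℤ) → ∑ h ≡ ∑ (λ x → h (embed (inj₁ x))) ℤ.+ ∑ (λ y → h (embed (inj₂ y)))

  partition : ∀ {n} (P : Pred (Fin n) 0ℓ) → Decidable P → Σ ℕ λ a → Σ ℕ λ b → Partition P a b
  partition {zero} P P? = 0 , 0 , record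
    { embed = λ { (inj₁ ()) ; (inj₂ ()) } ; classify = λ ()
    ; embed∘classify = λ () ; classify∘embed = λ { (inj₁ ()) ; (inj₂ ()) }
    ; inside = λ () ; outside = λ () ; size = refl ; ∑-split = λ _ → refl }
  partition {suc n} P P? with partition (λ i → P (suc i)) (λ i → P? (suc i)) | P? zero
  ... | a , b , Π | yes P0 = suc a , b , record
    { embed = embed′ ; classify = classify′
    ; embed∘classify = embed∘classify′ ; classify∘embed = classify∘embed′
    ; inside = λ { zero → P0 ; (suc x) → inside x } ; outside = outside ; size = cong suc size
    ; ∑-split = λ h → trans (cong (ℤ._+_ (h zero)) (∑-split (λ i → h (suc i)))) (sym (ℤP.+-assoc (h zero) _ _)) }
    where
    open Partition Π
    embed′ : Fin (suc a) ⊎ Fin b → Fin (suc n)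
    embed′ (inj₁ zero)    = zero
    embed′ (inj₁ (suc x)) = suc (embed (inj₁ x))
    embed′ (inj₂ y)       = suc (embed (inj₂ y))
    classify′ : Fin (suc n) → Fin (suc a) ⊎ Fin b
    classify′ zero = inj₁ zero
    classify′ (suc i) with classify i
    ... | inj₁ x = inj₁ (suc x)
    ... | inj₂ y = inj₂ y
    embed∘classify′ : ∀ i → embed′ (classify′ i) ≡ i
    embed∘classify′ zero = refl
    embed∘classify′ (suc i) with classify i | embed∘classify i
    ... | inj₁ x | eq = cong suc eq
    ... | inj₂ y | eq = cong suc eq
    classify∘embed′ : ∀ x → classify′ (embed′ x) ≡ x
    classify∘embed′ (inj₁ zero) = refl
    classify∘embed′ (inj₁ (suc x)) with classify (embed (inj₁ x)) | classify∘embed (inj₁ x)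
    ... | .(inj₁ x) | refl = refl
    classify∘embed′ (inj₂ y) with classify (embed (inj₂ y)) | classify∘embed (inj₂ y)
    ... | .(inj₂ y) | refl = refl
  ... | a , b , Π | no ¬P0 = a , suc b , record
    { embed = embed′ ; classify = classify′
    ; embed∘classify = embed∘classify′ ; classify∘embed = classify∘embed′
    ; inside = inside ; outside = λ { zero → ¬P0 ; (suc y) → outside y } ; size = trans (ℕP.+-suc a b) (cong suc size)
    ; ∑-split = λ h → trans (cong (ℤ._+_ (h zero)) (∑-split (λ i → h (suc i))))
                           (middleFour (h zero) (∑ (λ x → h (suc (embed (inj₁ x))))) (∑ (λ y → h (suc (embed (inj₂ y)))))) }
    where
    open Partition Π
    middleFour : ∀ x y z → x ℤ.+ (y ℤ.+ z) ≡ y ℤ.+ (x ℤ.+ z)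
    middleFour x y z = trans (sym (ℤP.+-assoc x y z)) (trans (cong (ℤ._+ z) (ℤP.+-comm x y)) (ℤP.+-assoc y x z))
    embed′ : Fin a ⊎ Fin (suc b) → Fin (suc n)
    embed′ (inj₂ zero)    = zero
    embed′ (inj₂ (suc y)) = suc (embed (inj₂ y))
    embed′ (inj₁ x)       = suc (embed (inj₁ x))
    classify′ : Fin (suc n) → Fin a ⊎ Fin (suc b)
    classify′ zero = inj₂ zero
    classify′ (suc i) with classify i
    ... | inj₁ x = inj₁ x
    ... | inj₂ y = inj₂ (suc y)
    embed∘classify′ : ∀ i → embed′ (classify′ i) ≡ i
    embed∘classify′ zero = refl
    embed∘classify′ (suc i) with classify i | embed∘classify i
    ... | inj₁ x | eq = cong suc eq
    ... | inj₂ y | eq = cong suc eq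
    classify∘embed′ : ∀ x → classify′ (embed′ x) ≡ x
    classify∘embed′ (inj₂ zero) = refl
    classify∘embed′ (inj₂ (suc y)) with classify (embed (inj₂ y)) | classify∘embed (inj₂ y)
    ... | .(inj₂ y) | refl = refl
    classify∘embed′ (inj₁ x) with classify (embed (inj₁ x)) | classify∘embed (inj₁ x)
    ... | .(inj₁ x) | refl = refl

  module _ {n} {P : Pred (Fin n) 0ℓ} where

    emptyInside⇒¬P : ∀ {b} → Partition P 0 b → ∀ i → ¬ P i
    emptyInside⇒¬P Π i with classify i | embed∘classify i
      where open Partition Π
    ... | inj₂ y | refl = Partition.outside Π y

    emptyOutside⇒P : ∀ {a} → Partition P a 0 → ∀ i → P i
    emptyOutside⇒P Π i with classify i | embed∘classify i
      where open Partition Π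
    ... | inj₁ x | refl = Partition.inside Π x

module InducedSubgraph where

  open import Data.Bool using (Bool; true; false; if_then_else_)
  open import Data.Fin using (Fin; _≟_)
  open import Data.Integer as ℤ using (ℤ; +_)
  import Data.Integer.Properties as ℤP
  open import Data.Integer.Tactic.RingSolver using (solve-∀)
  open import Function using (_∘_)
  open import Relation.Nullary using (yes; no; does)
  open import Relation.Nullary.Decidable using (dec-true; dec-false)
  open import Relation.Binary.PropositionalEquality using (_≡_; _≢_; refl; sym; trans; cong; cong₂; module ≡-Reasoning)
  open import Defs using (Digraph; adj; loopless; NormalDigraph)
  open IntegerMatrices
  open IntegerLaplacian

  induced : ∀ {n m} → Digraph n → (Fin m → Fin n) → Digraph m
  induced Γ e = record { adj = λ x y → adj Γ (e x) (e y) ; loopless = λ x → loopless Γ (e x) }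

  private
    δ : ∀ {m} → Fin m → Fin m → ℤ → ℤ
    δ s t β = if does (s ≟ t) then β else + 0

    does-sym : ∀ {m} (x y : Fin m) → does (x ≟ y) ≡ does (y ≟ x)
    does-sym x y with x ≟ y
    ... | yes refl = sym (dec-true (x ≟ x) refl)
    ... | no x≢y   = sym (dec-false (y ≟ x) (x≢y ∘ sym))

    does-injective : ∀ {m n} (e : Fin m → Fin n) → (∀ {x y} → e x ≡ e y → x ≡ y) → ∀ x y → does (e x ≟ e y) ≡ does (x ≟ y)
    does-injective e e-injective x y with x ≟ y
    ... | yes refl = dec-true (e x ≟ e x) refl
    ... | no x≢y   = dec-false (e x ≟ e y) (x≢y ∘ e-injective)

    *-δ : ∀ (b : Bool) y β → y ℤ.* (if b then β else + 0) ≡ (if b then y ℤ.* β else + 0)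
    *-δ true  y β = refl
    *-δ false y β = ℤP.*-zeroʳ y

    ∑-*-δ-difference : ∀ {m} (x x′ : Fin m) β (p : Fin m → ℤ) →
      ∑ (λ t → p t ℤ.* (δ t x β ℤ.- δ t x′ β)) ≡ (p x ℤ.- p x′) ℤ.* β
    ∑-*-δ-difference x x′ β p = begin
      ∑ (λ t → p t ℤ.* (δ t x β ℤ.- δ t x′ β))
        ≡⟨ ∑-cong (λ t → trans (RingP.x[y-z]≈xy-xz (p t) (δ t x β) (δ t x′ β)) (cong₂ ℤ._-_ (*-δ (does (t ≟ x)) (p t) β) (*-δ (does (t ≟ x′)) (p t) β))) ⟩
      ∑ (λ t → δ t x (p t ℤ.* β) ℤ.- δ t x′ (p t ℤ.* β))
        ≡⟨ ∑-distrib-- (λ t → δ t x (p t ℤ.* β)) (λ t → δ t x′ (p t ℤ.* β)) ⟩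
      ∑ (λ t → δ t x (p t ℤ.* β)) ℤ.- ∑ (λ t → δ t x′ (p t ℤ.* β))
        ≡⟨ cong₂ ℤ._-_ (∑-δʳ x (λ t → p t ℤ.* β)) (∑-δʳ x′ (λ t → p t ℤ.* β)) ⟩
      p x ℤ.* β ℤ.- p x′ ℤ.* β
        ≡⟨ RingP.[y-z]x≈yx-zx β (p x) (p x′) ⟨
      (p x ℤ.- p x′) ℤ.* β ∎
      where open ≡-Reasoning

    ∑-square-+ : ∀ {m} (p v : Fin m → ℤ) →
      ∑ (λ t → (p t ℤ.+ v t) ℤ.* (p t ℤ.+ v t)) ≡ ∑ (λ t → p t ℤ.* p t) ℤ.+ + 2 ℤ.* ∑ (λ t → p t ℤ.* v t) ℤ.+ ∑ (λ t → v t ℤ.* v t)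
    ∑-square-+ p v = begin
      ∑ (λ t → (p t ℤ.+ v t) ℤ.* (p t ℤ.+ v t))
        ≡⟨ ∑-cong (λ t → expand (p t) (v t)) ⟩
      ∑ (λ t → p t ℤ.* p t ℤ.+ + 2 ℤ.* (p t ℤ.* v t) ℤ.+ v t ℤ.* v t)
        ≡⟨ ∑-distrib-+ (λ t → p t ℤ.* p t ℤ.+ + 2 ℤ.* (p t ℤ.* v t)) (λ t → v t ℤ.* v t) ⟩
      ∑ (λ t → p t ℤ.* p t ℤ.+ + 2 ℤ.* (p t ℤ.* v t)) ℤ.+ ∑ (λ t → v t ℤ.* v t)
        ≡⟨ cong (ℤ._+ ∑ (λ t → v t ℤ.* v t)) (trans (∑-distrib-+ (λ t → p t ℤ.* p t) (λ t → + 2 ℤ.* (p t ℤ.* v t)))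
                                                     (cong (ℤ._+_ (∑ (λ t → p t ℤ.* p t))) (sym (*-distribˡ-∑ (+ 2) (λ t → p t ℤ.* v t))))) ⟩
      ∑ (λ t → p t ℤ.* p t) ℤ.+ + 2 ℤ.* ∑ (λ t → p t ℤ.* v t) ℤ.+ ∑ (λ t → v t ℤ.* v t) ∎
      where
      open ≡-Reasoning
      expand : ∀ a b → (a ℤ.+ b) ℤ.* (a ℤ.+ b) ≡ a ℤ.* a ℤ.+ + 2 ℤ.* (a ℤ.* b) ℤ.+ b ℤ.* b
      expand = solve-∀

    ∑-square-+-difference : ∀ {m} (p q v : Fin m → ℤ) → ∑ (λ t → p t ℤ.* v t) ≡ ∑ (λ t → q t ℤ.* v t) →
      ∑ (λ t → (p t ℤ.+ v t) ℤ.* (p t ℤ.+ v t)) ℤ.- ∑ (λ t → (q t ℤ.+ v t) ℤ.* (q t ℤ.+ v t)) ≡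
      ∑ (λ t → p t ℤ.* p t) ℤ.- ∑ (λ t → q t ℤ.* q t)
    ∑-square-+-difference p q v pv≡qv = begin
      ∑ (λ t → (p t ℤ.+ v t) ℤ.* (p t ℤ.+ v t)) ℤ.- ∑ (λ t → (q t ℤ.+ v t) ℤ.* (q t ℤ.+ v t))
        ≡⟨ cong₂ ℤ._-_ (∑-square-+ p v) (∑-square-+ q v) ⟩
      P ℤ.+ + 2 ℤ.* ∑ (λ t → p t ℤ.* v t) ℤ.+ V ℤ.- (Q ℤ.+ + 2 ℤ.* ∑ (λ t → q t ℤ.* v t) ℤ.+ V)
        ≡⟨ cong (λ c → P ℤ.+ + 2 ℤ.* c ℤ.+ V ℤ.- (Q ℤ.+ + 2 ℤ.* ∑ (λ t → q t ℤ.* v t) ℤ.+ V)) pv≡qv ⟩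
      P ℤ.+ + 2 ℤ.* ∑ (λ t → q t ℤ.* v t) ℤ.+ V ℤ.- (Q ℤ.+ + 2 ℤ.* ∑ (λ t → q t ℤ.* v t) ℤ.+ V)
        ≡⟨ cancel P Q (∑ (λ t → q t ℤ.* v t)) V ⟩
      P ℤ.- Q ∎
      where
      open ≡-Reasoning
      P = ∑ (λ t → p t ℤ.* p t)
      Q = ∑ (λ t → q t ℤ.* q t)
      V = ∑ (λ t → v t ℤ.* v t)
      cancel : ∀ a b c d → a ℤ.+ + 2 ℤ.* c ℤ.+ d ℤ.- (b ℤ.+ + 2 ℤ.* c ℤ.+ d) ≡ a ℤ.- b
      cancel = solve-∀

  module UniformlyJoined {n m m′} (Γ : Digraph n) (e : Fin m → Fin n) (e′ : Fin m′ → Fin n)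
    (e-injective : ∀ {x y} → e x ≡ e y → x ≡ y) (disjoint : ∀ x y → e x ≢ e′ y)
    (∑-split : ∀ (h : Fin n → ℤ) → ∑ h ≡ ∑ (h ∘ e) ℤ.+ ∑ (h ∘ e′))
    (κout κin : Bool) (arcs-out : ∀ x y → adj Γ (e x) (e′ y) ≡ κout) (arcs-in : ∀ x y → adj Γ (e′ y) (e x) ≡ κin) where

    Δ : Digraph m
    Δ = induced Γ e

    private
      L = laplacian Γ
      L₁ = laplacian Δ

    β : ℤ
    β = ∑ (λ (_ : Fin m′) → bit κout)

    outdeg-block : ∀ x → outdeg Γ (e x) ≡ outdeg Δ x ℤ.+ β
    outdeg-block x = trans (∑-split (arc Γ (e x))) (cong (ℤ._+_ (outdeg Δ x)) (∑-cong (λ y → cong bit (arcs-out x y))))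

    laplacian-block : ∀ x′ x → L (e x′) (e x) ≡ L₁ x′ x ℤ.+ δ x′ x β
    laplacian-block x′ x = begin
      (if does (e x′ ≟ e x) then outdeg Γ (e x′) else + 0) ℤ.- a
        ≡⟨ cong (λ b → (if b then outdeg Γ (e x′) else + 0) ℤ.- a) (does-injective e e-injective x′ x) ⟩
      (if does (x′ ≟ x) then outdeg Γ (e x′) else + 0) ℤ.- a
        ≡⟨ cong (λ o → (if does (x′ ≟ x) then o else + 0) ℤ.- a) (outdeg-block x′) ⟩
      (if does (x′ ≟ x) then outdeg Δ x′ ℤ.+ β else + 0) ℤ.- a
        ≡⟨ shift (does (x′ ≟ x)) ⟩
      L₁ x′ x ℤ.+ δ x′ x β ∎
      where
      open ≡-Reasoning
      a = arc Γ (e x′) (e x)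
      rearrange : ∀ o a b → o ℤ.+ b ℤ.- a ≡ o ℤ.- a ℤ.+ b
      rearrange = solve-∀
      shift : ∀ c → (if c then outdeg Δ x′ ℤ.+ β else + 0) ℤ.- a ≡ ((if c then outdeg Δ x′ else + 0) ℤ.- a) ℤ.+ (if c then β else + 0)
      shift true  = rearrange (outdeg Δ x′) a β
      shift false = sym (ℤP.+-identityʳ _)

    laplacian-in : ∀ y x → L (e′ y) (e x) ≡ ℤ.- bit κin
    laplacian-in y x = trans (laplacian-offDiagonal Γ (disjoint x y ∘ sym)) (cong (ℤ.-_ ∘ bit) (arcs-in x y))

    laplacian-out : ∀ x y → L (e x) (e′ y) ≡ ℤ.- bit κout
    laplacian-out x y = trans (laplacian-offDiagonal Γ (disjoint x y)) (cong (ℤ.-_ ∘ bit) (arcs-out x y))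

    imbalance-block : ∀ x → imbalance Γ (e x) ≡ imbalance Δ x ℤ.+ β ℤ.+ ∑ (λ (_ : Fin m′) → ℤ.- bit κin)
    imbalance-block x = trans (∑-split (λ t → L t (e x)))
      (cong₂ ℤ._+_ (trans (∑-cong (λ x′ → laplacian-block x′ x))
                         (trans (∑-distrib-+ (λ x′ → L₁ x′ x) (λ x′ → δ x′ x β)) (cong (ℤ._+_ (imbalance Δ x)) (∑-δʳ x (λ _ → β)))))
                   (∑-cong (λ y → laplacian-in y x)))

    -- The diagonal shift β I changes both squared distances by the same amount, and the rows and
    -- columns through e′ are constant on the image of e.
    distanceDefect-block : ∀ x x′ → distanceDefect L (e x) (e x′) ≡ distanceDefect L₁ x x′
    distanceDefect-block x x′ = trans (cong₂ ℤ._-_ columns rows) (∑-square-+-difference p q v pv≡qv)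
      where
      v : Fin m → ℤ
      v t = δ t x β ℤ.- δ t x′ β
      p q : Fin m → ℤ
      p t = L₁ t x ℤ.- L₁ t x′
      q t = L₁ x t ℤ.- L₁ x′ t
      interchange : ∀ a b c d → (a ℤ.+ c) ℤ.- (b ℤ.+ d) ≡ (a ℤ.- b) ℤ.+ (c ℤ.- d)
      interchange = solve-∀
      constant² : ∀ k → (ℤ.- k ℤ.- ℤ.- k) ℤ.* (ℤ.- k ℤ.- ℤ.- k) ≡ + 0
      constant² k = cong (λ z → z ℤ.* z) (ℤP.+-inverseʳ (ℤ.- k))
      square : ℤ → ℤ
      square z = z ℤ.* z
      columns : columnDistance² L (e x) (e x′) ≡ ∑ (λ t → square (p t ℤ.+ v t))
      columns = trans (∑-split (λ t → square (L t (e x) ℤ.- L t (e x′))))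
        (trans (cong₂ ℤ._+_
          (∑-cong (λ t → cong square (trans (cong₂ ℤ._-_ (laplacian-block t x) (laplacian-block t x′))
                                            (interchange (L₁ t x) (L₁ t x′) (δ t x β) (δ t x′ β)))))
          (∑-≈0 (λ y → trans (cong₂ (λ a b → square (a ℤ.- b)) (laplacian-in y x) (laplacian-in y x′)) (constant² (bit κin)))))
          (ℤP.+-identityʳ _))
      v-sym : ∀ t → δ x t β ℤ.- δ x′ t β ≡ v t
      v-sym t = cong₂ (λ b c → (if b then β else + 0) ℤ.- (if c then β else + 0)) (does-sym x t) (does-sym x′ t)
      rows : columnDistance² (transpose L) (e x) (e x′) ≡ ∑ (λ t → square (q t ℤ.+ v t))
      rows = trans (∑-split (λ t → square (L (e x) t ℤ.- L (e x′) t)))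
        (trans (cong₂ ℤ._+_
          (∑-cong (λ t → cong square (trans (cong₂ ℤ._-_ (laplacian-block x t) (laplacian-block x′ t))
                                            (trans (interchange (L₁ x t) (L₁ x′ t) (δ x t β) (δ x′ t β)) (cong (ℤ._+_ (q t)) (v-sym t))))))
          (∑-≈0 (λ y → trans (cong₂ (λ a b → square (a ℤ.- b)) (laplacian-out x y) (laplacian-out x′ y)) (constant² (bit κout)))))
          (ℤP.+-identityʳ _))
      pv≡qv : ∑ (λ t → p t ℤ.* v t) ≡ ∑ (λ t → q t ℤ.* v t)
      pv≡qv = trans (∑-*-δ-difference x x′ β p)
                (trans (cong (ℤ._* β) (swapMiddle (L₁ x x) (L₁ x x′) (L₁ x′ x) (L₁ x′ x′))) (sym (∑-*-δ-difference x x′ β q)))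
        where
        swapMiddle : ∀ a b c d → (a ℤ.- b) ℤ.- (c ℤ.- d) ≡ (a ℤ.- c) ℤ.- (b ℤ.- d)
        swapMiddle = solve-∀

    normal-if-defect-free : (∀ x x′ → distanceDefect L (e x) (e x′) ≡ + 0) → (∀ x → imbalance Δ x ≡ + 0) → NormalDigraph Δ
    normal-if-defect-free defect≡0 Δ-balanced = balanced⇒normal Δ Δ-balanced
      (λ x x′ → ℤP.i-j≡0⇒i≡j _ _ (trans (sym (distanceDefect-block x x′)) (defect≡0 x x′)))

module ImbalanceClasses {n′} (Γ : Digraph (suc n′)) (hyp : SquareFreeDivisibility.SquareFreeOrTwiceSquareFree (suc n′))
  (satisfiesIdentity : ∀ i j → IntegerMatrices.RestrictedNormalIdentity (IntegerMatrices.laplacian Γ) i j) where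

  open import Data.Nat as ℕ using (ℕ; zero; suc)
  open import Defs using (Digraph; adj; NormalDigraph; IsJoinOfNormals; directedJoin)

  import Data.Nat.Properties as ℕP
  open import Data.Bool using (Bool; true; false)
  open import Data.Fin using (Fin; zero; suc; splitAt; join)
  open import Data.Fin.Properties using (splitAt-join; join-splitAt)
  open import Data.Integer as ℤ using (ℤ; +_; -[1+_]; _<_; _≤_)
  import Data.Integer.Properties as ℤP
  open import Data.Integer.Tactic.RingSolver using (solve-∀)
  open import Data.Product using (∃; _×_; _,_; proj₁; proj₂)
  open import Data.Sum using (_⊎_; inj₁; inj₂)
  open import Data.Sum.Properties using (inj₁-injective; inj₂-injective)
  open import Function using (_∘_)
  open import Function.Bundles using (_↔_; mk↔ₛ′)
  open import Relation.Nullary using (¬_)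
  open import Relation.Nullary.Negation using (contradiction)
  open import Relation.Binary.PropositionalEquality using (_≡_; _≢_; refl; sym; trans; cong; cong₂; subst; module ≡-Reasoning)
  open IntegerMatrices
  open IntegerLaplacian
  open SquareFreeDivisibility using (∣square⇒∣ℤ)
  open FinPartition
  open InducedSubgraph using (module UniformlyJoined)

  private
    n : ℕ
    n = suc n′
    w = imbalance Γ
    L = laplacian Γ

    -n<n*q<n⇒n*q≡0 : ∀ m q → ℤ.- + m < + m ℤ.* q → + m ℤ.* q < + m → + m ℤ.* q ≡ + 0
    -n<n*q<n⇒n*q≡0 zero    q       _ _ = refl
    -n<n*q<n⇒n*q≡0 (suc m) (+ zero) _ _ = ℤP.*-zeroʳ (+ suc m)
    -n<n*q<n⇒n*q≡0 (suc m) (+ suc r) _ (ℤ.+<+ lt) = contradiction lt (ℕP.≤⇒≯ (ℕP.m≤m*n (suc m) (suc r)))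
    -n<n*q<n⇒n*q≡0 (suc m) -[1+ r ] (ℤ.-<- lt) _ =
      contradiction lt (ℕP.≤⇒≯ (ℕP.≤-trans (ℕP.m≤m*n m (suc r)) (ℕP.m≤n+m (m ℕ.* suc r) r)))

    0<n*q<2n⇒n*q≡n : ∀ m q → + 0 < + m ℤ.* q → + m ℤ.* q < + m ℤ.+ + m → + m ℤ.* q ≡ + m
    0<n*q<2n⇒n*q≡n zero    q              (ℤ.+<+ ()) _
    0<n*q<2n⇒n*q≡n (suc m) (+ zero)       0<0 _ = contradiction (subst (+ 0 <_) (ℤP.*-zeroʳ (+ suc m)) 0<0) (ℤP.<-irrefl refl)
    0<n*q<2n⇒n*q≡n (suc m) (+ suc zero)   _ _ = ℤP.*-identityʳ (+ suc m)
    0<n*q<2n⇒n*q≡n (suc m) (+ suc (suc r)) _ (ℤ.+<+ lt) = contradiction lt (ℕP.≤⇒≯ 2m≤m*r)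
      where
      2m≤m*r : suc m ℕ.+ suc m ℕ.≤ suc m ℕ.* suc (suc r)
      2m≤m*r = subst (suc m ℕ.+ suc m ℕ.≤_) (sym (trans (ℕP.*-suc (suc m) (suc r)) (cong (suc m ℕ.+_) (ℕP.*-suc (suc m) r))))
                     (ℕP.+-monoʳ-≤ (suc m) (ℕP.m≤m+n (suc m) (suc m ℕ.* r)))
    0<n*q<2n⇒n*q≡n (suc m) -[1+ r ] () _

  n∣imbalance-difference : ∀ i j → ∃ λ q → w i ℤ.- w j ≡ + n ℤ.* q
  n∣imbalance-difference i j with identity-parity Γ i j
  ... | e , parity = ∣square⇒∣ℤ n hyp (distanceDefect L i j) (w i ℤ.- w j) e
                       (trans (cong (ℤ._* distanceDefect L i j) (sym (fromℕ≡+ n))) (satisfiesIdentity i j)) parity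

  equalImbalance⇒distanceDefect≡0 : ∀ i j → w i ≡ w j → distanceDefect L i j ≡ + 0
  equalImbalance⇒distanceDefect≡0 i j wi≡wj = ℤP.*-cancelˡ-≡ (+ n) (distanceDefect L i j) (+ 0) (begin
    + n ℤ.* distanceDefect L i j      ≡⟨ cong (ℤ._* distanceDefect L i j) (fromℕ≡+ n) ⟨
    fromℕ n ℤ.* distanceDefect L i j  ≡⟨ satisfiesIdentity i j ⟩
    (w i ℤ.- w j) ℤ.* (w i ℤ.- w j)   ≡⟨ cong (λ d → d ℤ.* d) (trans (cong (ℤ._- w j) wi≡wj) (ℤP.+-inverseʳ (w j))) ⟩
    + 0                               ≡⟨ ℤP.*-zeroʳ (+ n) ⟨
    + n ℤ.* + 0                       ∎)
    where open ≡-Reasoning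

  equalImbalance⇒distance≡ : ∀ i j → w i ≡ w j → columnDistance² L i j ≡ columnDistance² (transpose L) i j
  equalImbalance⇒distance≡ i j wi≡wj = ℤP.i-j≡0⇒i≡j _ _ (equalImbalance⇒distanceDefect≡0 i j wi≡wj)

  private
    -- Two imbalances less than n apart are congruent modulo n, hence equal.
    close⇒equal : ∀ i j → ℤ.- + n < w i ℤ.- w j → w i ℤ.- w j < + n → w i ≡ w j
    close⇒equal i j lower upper with n∣imbalance-difference i j
    ... | q , wi-wj≡nq = ℤP.i-j≡0⇒i≡j (w i) (w j)
      (trans wi-wj≡nq (-n<n*q<n⇒n*q≡0 n q (subst (ℤ.- + n <_) wi-wj≡nq lower) (subst (_< + n) wi-wj≡nq upper)))

    -wj<n : ∀ j → ℤ.- w j < + n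
    -wj<n j = subst (ℤ.- w j <_) (ℤP.neg-involutive (+ n)) (ℤP.neg-mono-< (-n<imbalance Γ j))

  positive-imbalance-constant : ∀ i j → + 0 < w i → + 0 < w j → w i ≡ w j
  positive-imbalance-constant i j 0<wi 0<wj = close⇒equal i j
    (subst (_< w i ℤ.- w j) (ℤP.+-identityˡ (ℤ.- + n)) (ℤP.+-mono-< 0<wi (ℤP.neg-mono-< (imbalance<n Γ j))))
    (subst (w i ℤ.- w j <_) (ℤP.+-identityʳ (+ n)) (ℤP.+-mono-< (imbalance<n Γ i) (ℤP.neg-mono-< 0<wj)))

  nonpositive-imbalance-constant : ∀ i j → w i ≤ + 0 → w j ≤ + 0 → w i ≡ w j
  nonpositive-imbalance-constant i j wi≤0 wj≤0 = close⇒equal i j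
    (subst (_< w i ℤ.- w j) (ℤP.+-identityʳ (ℤ.- + n)) (ℤP.+-mono-<-≤ (-n<imbalance Γ i) (ℤP.neg-mono-≤ wj≤0)))
    (subst (w i ℤ.- w j <_) (ℤP.+-identityˡ (+ n)) (ℤP.+-mono-≤-< wi≤0 (-wj<n j)))

  positive-nonpositive-gap : ∀ i j → + 0 < w i → w j ≤ + 0 → w i ℤ.- w j ≡ + n
  positive-nonpositive-gap i j 0<wi wj≤0 with n∣imbalance-difference i j
  ... | q , wi-wj≡nq = trans wi-wj≡nq (0<n*q<2n⇒n*q≡n n q
    (subst (+ 0 <_) wi-wj≡nq (ℤP.+-mono-<-≤ 0<wi (ℤP.neg-mono-≤ wj≤0)))
    (subst (_< + n ℤ.+ + n) wi-wj≡nq (ℤP.+-mono-< (imbalance<n Γ i) (-wj<n j))))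

  -- A constant imbalance sums to zero, so it vanishes; then Γ is normal.
  constant-imbalance⇒normal : (∀ i j → w i ≡ w j) → NormalDigraph Γ
  constant-imbalance⇒normal w-constant = balanced⇒normal Γ w≡0 (λ i j → equalImbalance⇒distance≡ i j (w-constant i j))
    where
    w₀≡0 : w zero ≡ + 0
    w₀≡0 = ℤP.*-cancelˡ-≡ (+ n) (w zero) (+ 0) (begin
      + n ℤ.* w zero        ≡⟨ ∑-const-ℤ n (w zero) ⟨
      ∑ {n} (λ _ → w zero)  ≡⟨ ∑-cong (λ i → w-constant i zero) ⟨
      ∑ w                   ≡⟨ ∑-imbalance≡0 Γ ⟩
      + 0                   ≡⟨ ℤP.*-zeroʳ (+ n) ⟨
      + n ℤ.* + 0           ∎)
      where open ≡-Reasoning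
    w≡0 : ∀ i → w i ≡ + 0
    w≡0 i = trans (w-constant i zero) w₀≡0

  Positive : Fin n → Set
  Positive i = + 0 < w i

  module Join {k m} (Π : Partition Positive (suc k) (suc m)) where
    open Partition Π

    private
      a b : ℕ
      a = suc k
      b = suc m
      embed₁ : Fin a → Fin n
      embed₁ x = embed (inj₁ x)
      embed₂ : Fin b → Fin n
      embed₂ y = embed (inj₂ y)

    embed₁-injective : ∀ {x x′} → embed₁ x ≡ embed₁ x′ → x ≡ x′
    embed₁-injective {x} {x′} eq = inj₁-injective (trans (sym (classify∘embed (inj₁ x))) (trans (cong classify eq) (classify∘embed (inj₁ x′))))

    embed₂-injective : ∀ {y y′} → embed₂ y ≡ embed₂ y′ → y ≡ y′
    embed₂-injective {y} {y′} eq = inj₂-injective (trans (sym (classify∘embed (inj₂ y))) (trans (cong classify eq) (classify∘embed (inj₂ y′))))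

    disjoint : ∀ x y → embed₁ x ≢ embed₂ y
    disjoint x y eq with trans (sym (classify∘embed (inj₁ x))) (trans (cong classify eq) (classify∘embed (inj₂ y)))
    ... | ()

    c : ℤ
    c = w (embed₁ zero)

    w∘embed₁ : ∀ x → w (embed₁ x) ≡ c
    w∘embed₁ x = positive-imbalance-constant (embed₁ x) (embed₁ zero) (inside x) (inside zero)

    w∘embed₂ : ∀ y → w (embed₂ y) ≡ c ℤ.- + n
    w∘embed₂ y = trans (subtractBack (w (embed₂ y)) c)
                       (cong (ℤ._-_ c) (positive-nonpositive-gap (embed₁ zero) (embed₂ y) (inside zero) (ℤP.≮⇒≥ (outside y))))
      where
      subtractBack : ∀ x c → x ≡ c ℤ.- (c ℤ.- x)
      subtractBack = solve-∀

    n≡a+b : + n ≡ + a ℤ.+ + b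
    n≡a+b = cong +_ (sym size)

    -- The imbalances sum to zero: a c + b (c - n) = 0 with n = a + b.
    c≡b : c ≡ + b
    c≡b = ℤP.i-j≡0⇒i≡j c (+ b) (ℤP.*-cancelˡ-≡ (+ a ℤ.+ + b) (c ℤ.- + b) (+ 0) (begin
      (+ a ℤ.+ + b) ℤ.* (c ℤ.- + b)                          ≡⟨ regroup (+ a) (+ b) c ⟨
      + a ℤ.* c ℤ.+ + b ℤ.* (c ℤ.- (+ a ℤ.+ + b))            ≡⟨ cong₂ ℤ._+_ (trans (sym (∑-const-ℤ a c)) (∑-cong (sym ∘ w∘embed₁)))
                                                                           (trans (cong (λ z → + b ℤ.* (c ℤ.- z)) (sym n≡a+b))
                                                                           (trans (sym (∑-const-ℤ b (c ℤ.- + n))) (∑-cong (sym ∘ w∘embed₂)))) ⟩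
      ∑ (w ∘ embed₁) ℤ.+ ∑ (w ∘ embed₂)                       ≡⟨ ∑-split w ⟨
      ∑ w                                                     ≡⟨ ∑-imbalance≡0 Γ ⟩
      + 0                                                     ≡⟨ ℤP.*-zeroʳ (+ a ℤ.+ + b) ⟨
      (+ a ℤ.+ + b) ℤ.* + 0                                   ∎))
      where
      open ≡-Reasoning
      regroup : ∀ A B c → A ℤ.* c ℤ.+ B ℤ.* (c ℤ.- (A ℤ.+ B)) ≡ (A ℤ.+ B) ℤ.* (c ℤ.- B)
      regroup = solve-∀

    private
      balance : Fin n → Fin n → ℤ
      balance i t = arc Γ i t ℤ.- arc Γ t i

      slack : ∀ p q → + 0 ≤ + 1 ℤ.- (bit p ℤ.- bit q)
      slack true  true  = ℤ.+≤+ ℕ.z≤n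
      slack true  false = ℤ.+≤+ ℕ.z≤n
      slack false true  = ℤ.+≤+ ℕ.z≤n
      slack false false = ℤ.+≤+ ℕ.z≤n

      slack≡0 : ∀ p q → + 1 ℤ.- (bit p ℤ.- bit q) ≡ + 0 → p ≡ true × q ≡ false
      slack≡0 true  false _  = refl , refl
      slack≡0 true  true  ()
      slack≡0 false true  ()
      slack≡0 false false ()

    -- Arcs inside the positive class cancel in pairs, so the positive imbalances add up to
    -- the net number of arcs from the positive to the nonpositive class.
    crossBalance : ∑ (λ x → ∑ (λ y → balance (embed₁ x) (embed₂ y))) ≡ + a ℤ.* + b
    crossBalance = begin
      ∑ (λ x → ∑ (λ y → balance (embed₁ x) (embed₂ y)))
        ≡⟨ ℤP.+-identityˡ _ ⟨
      + 0 ℤ.+ ∑ (λ x → ∑ (λ y → balance (embed₁ x) (embed₂ y)))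
        ≡⟨ cong (ℤ._+ ∑ (λ x → ∑ (λ y → balance (embed₁ x) (embed₂ y))))
                (sym (∑∑-antisymmetric (λ x x′ → balance (embed₁ x) (embed₁ x′)) (λ x x′ → x-y≡-[y-x] (arc Γ (embed₁ x) (embed₁ x′)) (arc Γ (embed₁ x′) (embed₁ x))))) ⟩
      ∑ (λ x → ∑ (λ x′ → balance (embed₁ x) (embed₁ x′))) ℤ.+ ∑ (λ x → ∑ (λ y → balance (embed₁ x) (embed₂ y)))
        ≡⟨ ∑-distrib-+ (λ x → ∑ (λ x′ → balance (embed₁ x) (embed₁ x′))) (λ x → ∑ (λ y → balance (embed₁ x) (embed₂ y))) ⟨
      ∑ (λ x → ∑ (λ x′ → balance (embed₁ x) (embed₁ x′)) ℤ.+ ∑ (λ y → balance (embed₁ x) (embed₂ y)))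
        ≡⟨ ∑-cong (λ x → trans (sym (∑-split (balance (embed₁ x)))) (sym (imbalance≡∑arcBalance Γ (embed₁ x)))) ⟩
      ∑ (w ∘ embed₁)          ≡⟨ ∑-cong w∘embed₁ ⟩
      ∑ {a} (λ _ → c)         ≡⟨ ∑-const-ℤ a c ⟩
      + a ℤ.* c               ≡⟨ cong (ℤ._*_ (+ a)) c≡b ⟩
      + a ℤ.* + b             ∎
      where
      open ≡-Reasoning

    -- Each cross term is at most 1, and a b of them sum to a b.
    crossArcs : ∀ x y → adj Γ (embed₁ x) (embed₂ y) ≡ true × adj Γ (embed₂ y) (embed₁ x) ≡ false
    crossArcs x y = slack≡0 (adj Γ (embed₁ x) (embed₂ y)) (adj Γ (embed₂ y) (embed₁ x))
      (∑≡0⇒≡0 (slack′ x) (∑≡0⇒≡0 (λ x → 0≤∑ (slack′ x)) ∑∑slack≡0 x) y)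
      where
      slack′ : ∀ x y → + 0 ≤ + 1 ℤ.- balance (embed₁ x) (embed₂ y)
      slack′ x y = slack (adj Γ (embed₁ x) (embed₂ y)) (adj Γ (embed₂ y) (embed₁ x))
      ∑∑slack≡0 : ∑ (λ x → ∑ (λ y → + 1 ℤ.- balance (embed₁ x) (embed₂ y))) ≡ + 0
      ∑∑slack≡0 = begin
        ∑ (λ x → ∑ (λ y → + 1 ℤ.- balance (embed₁ x) (embed₂ y)))
          ≡⟨ ∑-cong (λ x → trans (∑-distrib-- (λ _ → + 1) (λ y → balance (embed₁ x) (embed₂ y)))
                                 (cong (ℤ._- ∑ (λ y → balance (embed₁ x) (embed₂ y))) (trans (∑-const-ℤ b (+ 1)) (ℤP.*-identityʳ (+ b))))) ⟩
        ∑ (λ x → + b ℤ.- ∑ (λ y → balance (embed₁ x) (embed₂ y)))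
          ≡⟨ ∑-distrib-- (λ _ → + b) (λ x → ∑ (λ y → balance (embed₁ x) (embed₂ y))) ⟩
        ∑ {a} (λ _ → + b) ℤ.- ∑ (λ x → ∑ (λ y → balance (embed₁ x) (embed₂ y)))
          ≡⟨ cong₂ ℤ._-_ (∑-const-ℤ a (+ b)) crossBalance ⟩
        + a ℤ.* + b ℤ.- + a ℤ.* + b
          ≡⟨ ℤP.+-inverseʳ (+ a ℤ.* + b) ⟩
        + 0 ∎
        where open ≡-Reasoning

    private
      module PositiveClass = UniformlyJoined Γ embed₁ embed₂ embed₁-injective disjoint ∑-split true false
                          (λ x y → proj₁ (crossArcs x y)) (λ x y → proj₂ (crossArcs x y))
      module NonpositiveClass = UniformlyJoined Γ embed₂ embed₁ embed₂-injective (λ y x eq → disjoint x y (sym eq))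
                             (λ h → trans (∑-split h) (ℤP.+-comm (∑ (h ∘ embed₁)) (∑ (h ∘ embed₂)))) false true
                             (λ y x → proj₂ (crossArcs x y)) (λ y x → proj₁ (crossArcs x y))

      ∑-ones : ∀ p → ∑ {p} (λ _ → + 1) ≡ + p
      ∑-ones p = trans (∑-const-ℤ p (+ 1)) (ℤP.*-identityʳ (+ p))

      ∑-zeros : ∀ p → ∑ {p} (λ _ → + 0) ≡ + 0
      ∑-zeros p = ∑-≈0 {p} (λ _ → refl)

    Γ₁ : Digraph a
    Γ₁ = PositiveClass.Δ

    Γ₂ : Digraph b
    Γ₂ = NonpositiveClass.Δ

    Γ₁-normal : NormalDigraph Γ₁
    Γ₁-normal = PositiveClass.normal-if-defect-free
      (λ x x′ → equalImbalance⇒distanceDefect≡0 (embed₁ x) (embed₁ x′) (trans (w∘embed₁ x) (sym (w∘embed₁ x′)))) balanced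
      where
      balanced : ∀ x → imbalance Γ₁ x ≡ + 0
      balanced x = begin
        imbalance Γ₁ x                                            ≡⟨ offset (imbalance Γ₁ x) (+ b) ⟩
        imbalance Γ₁ x ℤ.+ + b ℤ.+ + 0 ℤ.- + b                   ≡⟨ cong₂ (λ β γ → imbalance Γ₁ x ℤ.+ β ℤ.+ γ ℤ.- + b)
                                                                            (sym (∑-ones b)) (sym (∑-zeros b)) ⟩
        imbalance Γ₁ x ℤ.+ PositiveClass.β ℤ.+ ∑ (λ (_ : Fin b) → ℤ.- + 0) ℤ.- + b ≡⟨ cong (ℤ._- + b) (PositiveClass.imbalance-block x) ⟨
        w (embed₁ x) ℤ.- + b                                      ≡⟨ cong (ℤ._- + b) (trans (w∘embed₁ x) c≡b) ⟩
        + b ℤ.- + b                                               ≡⟨ ℤP.+-inverseʳ (+ b) ⟩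
        + 0                                                       ∎
        where
        open ≡-Reasoning
        offset : ∀ x b → x ≡ x ℤ.+ b ℤ.+ + 0 ℤ.- b
        offset = solve-∀

    Γ₂-normal : NormalDigraph Γ₂
    Γ₂-normal = NonpositiveClass.normal-if-defect-free
      (λ y y′ → equalImbalance⇒distanceDefect≡0 (embed₂ y) (embed₂ y′) (trans (w∘embed₂ y) (sym (w∘embed₂ y′)))) balanced
      where
      balanced : ∀ y → imbalance Γ₂ y ≡ + 0
      balanced y = begin
        imbalance Γ₂ y                                              ≡⟨ offset (imbalance Γ₂ y) (+ a) (+ b) ⟩
        imbalance Γ₂ y ℤ.+ + 0 ℤ.+ ℤ.- + a ℤ.- (+ b ℤ.- (+ a ℤ.+ + b))
          ≡⟨ cong₂ (λ β γ → imbalance Γ₂ y ℤ.+ β ℤ.+ γ ℤ.- (+ b ℤ.- (+ a ℤ.+ + b)))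
                   (sym (∑-zeros a)) (sym (trans (∑-neg (λ (_ : Fin a) → + 1)) (cong ℤ.-_ (∑-ones a)))) ⟩
        imbalance Γ₂ y ℤ.+ NonpositiveClass.β ℤ.+ ∑ (λ (_ : Fin a) → ℤ.- + 1) ℤ.- (+ b ℤ.- (+ a ℤ.+ + b))
          ≡⟨ cong (ℤ._- (+ b ℤ.- (+ a ℤ.+ + b))) (NonpositiveClass.imbalance-block y) ⟨
        w (embed₂ y) ℤ.- (+ b ℤ.- (+ a ℤ.+ + b))
          ≡⟨ cong (ℤ._- (+ b ℤ.- (+ a ℤ.+ + b))) (trans (w∘embed₂ y) (cong₂ ℤ._-_ c≡b n≡a+b)) ⟩
        (+ b ℤ.- (+ a ℤ.+ + b)) ℤ.- (+ b ℤ.- (+ a ℤ.+ + b))     ≡⟨ ℤP.+-inverseʳ (+ b ℤ.- (+ a ℤ.+ + b)) ⟩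
        + 0                                                       ∎
        where
        open ≡-Reasoning
        offset : ∀ x a b → x ≡ x ℤ.+ + 0 ℤ.+ ℤ.- a ℤ.- (b ℤ.- (a ℤ.+ b))
        offset = solve-∀

    isJoinOfNormals : IsJoinOfNormals Γ
    isJoinOfNormals = k , m , Γ₁ , Γ₂ , Γ₁-normal , Γ₂-normal , σ , adj≡directedJoin
      where
      σ : Fin n ↔ Fin (a ℕ.+ b)
      σ = mk↔ₛ′ (join a b ∘ classify) (embed ∘ splitAt a)
                (λ z → trans (cong (join a b) (classify∘embed (splitAt a z))) (join-splitAt a b z))
                (λ i → trans (cong embed (splitAt-join a b (classify i))) (embed∘classify i))
      blocks : Fin a ⊎ Fin b → Fin a ⊎ Fin b → Bool
      blocks (inj₁ x) (inj₁ x′) = adj Γ₁ x x′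
      blocks (inj₁ _) (inj₂ _)  = true
      blocks (inj₂ _) (inj₁ _)  = false
      blocks (inj₂ y) (inj₂ y′) = adj Γ₂ y y′
      directedJoin≡blocks : ∀ s t → directedJoin Γ₁ Γ₂ s t ≡ blocks (splitAt a s) (splitAt a t)
      directedJoin≡blocks s t with splitAt a s | splitAt a t
      ... | inj₁ _ | inj₁ _ = refl
      ... | inj₁ _ | inj₂ _ = refl
      ... | inj₂ _ | inj₁ _ = refl
      ... | inj₂ _ | inj₂ _ = refl
      adj≡blocks : ∀ u v → adj Γ (embed u) (embed v) ≡ blocks u v
      adj≡blocks (inj₁ x) (inj₁ x′) = refl
      adj≡blocks (inj₁ x) (inj₂ y)  = proj₁ (crossArcs x y)
      adj≡blocks (inj₂ y) (inj₁ x)  = proj₂ (crossArcs x y)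
      adj≡blocks (inj₂ y) (inj₂ y′) = refl
      adj≡directedJoin : ∀ i j → adj Γ i j ≡ directedJoin Γ₁ Γ₂ (join a b (classify i)) (join a b (classify j))
      adj≡directedJoin i j = begin
        adj Γ i j                                                ≡⟨ cong₂ (adj Γ) (embed∘classify i) (embed∘classify j) ⟨
        adj Γ (embed (classify i)) (embed (classify j))          ≡⟨ adj≡blocks (classify i) (classify j) ⟩
        blocks (classify i) (classify j)                         ≡⟨ cong₂ blocks (splitAt-join a b (classify i)) (splitAt-join a b (classify j)) ⟨
        blocks (splitAt a (join a b (classify i))) (splitAt a (join a b (classify j)))
                                                                 ≡⟨ directedJoin≡blocks (join a b (classify i)) (join a b (classify j)) ⟨
        directedJoin Γ₁ Γ₂ (join a b (classify i)) (join a b (classify j)) ∎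
        where open ≡-Reasoning

  -- The vertices of positive imbalance and the remaining ones both form nonempty classes,
  -- since otherwise the imbalance is constant and Γ is normal.
  restrictedNormal⇒join : ¬ NormalDigraph Γ → IsJoinOfNormals Γ
  restrictedNormal⇒join ¬normal with partition Positive (λ i → + 0 ℤ.<? w i)
  ... | zero  , _     , Π = contradiction (constant-imbalance⇒normal λ i j →
          nonpositive-imbalance-constant i j (ℤP.≮⇒≥ (emptyInside⇒¬P Π i)) (ℤP.≮⇒≥ (emptyInside⇒¬P Π j))) ¬normal
  ... | suc _ , zero  , Π = contradiction (constant-imbalance⇒normal λ i j →
          positive-imbalance-constant i j (emptyOutside⇒P Π i) (emptyOutside⇒P Π j)) ¬normal
  ... | suc _ , suc _ , Π = Join.isJoinOfNormals Π

open import Defs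
open import Level using (Level)
open import Data.Nat using (ℕ; _∸_; _*_; zero; suc)
open import Data.Sum using (_⊎_)
open import Data.Product using (Σ; _×_; _,_)
open import Relation.Binary.PropositionalEquality using (_≡_)
open import Relation.Nullary.Negation using (contradiction)

theorem3p10 : ∀ {c ℓ : Level} (K : CommutativeRing c ℓ) → IsChar0Field K →
    (n : ℕ) → (SquareFree n ⊎ Σ ℕ (λ m → SquareFree m × n ≡ 2 * m)) →
    (Γ : Digraph n) (Q : MatrixOps.Matrix K n (n ∸ 1)) →
    MatrixOps.IsRestrictor K Q → RestrictedNormalVia K Γ Q →
    IsJoinOfNormals Γ
theorem3p10 K K-char0 zero     _   Γ Q _            (¬normal , _)      = contradiction (λ ()) ¬normal
theorem3p10 K K-char0 (suc n′) hyp Γ Q isRestrictor (¬normal , normal) =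
  ImbalanceClasses.restrictedNormal⇒join Γ hyp
    (LaplacianTransfer.restrictedNormal⇒ℤ-identity K K-char0 Γ Q isRestrictor normal) ¬normal
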